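{- Let $G$ be a simple graph with vertex set $[d]$ and $E$ edges, and let $\Delta_G$ be its (truncated) coloring complex. Then the number of facets of $\Delta_G$, and thus the sum of the coordinates of the $h$-vector of $\Delta_G$, equals $E\cdot(d-1)!$.
   Context: $G$ is a simple graph with vertex set $[d]$. For $\pi=a_1\cdots a_d\in\mathcal S_d$ and $k\in[d]$, $\ell(k)$ is the largest $r\ge0$ such that there are indices $i_0<\cdots<i_r=k$ with $a_{i_{s-1}}$ adjacent to $a_{i_s}$ in $G$ for all $s$. An integer $k\in\{0,\dots,d-1\}$ is a cut of $\pi$ if $k=0$, or $\ell(k)<\ell(k+1)$, or $\ell(k)=\ell(k+1)$ and $a_k<a_{k+1}$. If the cuts are $0=i_1<\cdots<i_q$, the $G$-sequence of $\pi$ is $S_1,\dots,S_q$ with $S_j=\{a_{i_j+1},\dots,a_{i_{j+1}}\}$ for $j<q$ and $S_q=\{a_{i_q+1},\dots,a_d\}$; the short $G$-sequence is $S_1,\dots,S_{q-1}$. A basic chain is a chain $\emptyset\subsetneq S_1\subsetneq\cdots\subsetneq S_k\subsetneq[d]$ ($k\ge0$) such that some $\pi\in\mathcal S_d$ has short $G$-sequence $S_1,S_2\setminus S_1,\dots,S_k\setminus S_{k-1}$. The (truncated) coloring complex $\Delta_G$ is the simplicial complex whose vertices are nonempty proper subsets of $[d]$ and whose faces are the chains of such subsets that contain no basic chain as a subset. The $h$-vector of a complex of dimension $\delta$ is the coefficient sequence of the numerator of the Hilbert series of its face ring written over $(1-t)^{\delta+1}$. -}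

module Defs where

open import Data.Bool using (Bool; true; false; if_then_else_; _∧_; _∨_)
open import Data.Nat using (ℕ; zero; suc; _⊔_; _<ᵇ_; _≡ᵇ_)
open import Data.Fin using (Fin; toℕ)
open import Data.Fin.Subset using (Subset; ⊥; ⊤; ⁅_⁆; _∪_; _─_; _⊂_)
open import Data.Fin.Permutation using (Permutation′; _⟨$⟩ʳ_)
open import Data.List using (List; []; _∷_; [_]; _++_; map; foldr; allFin; length)
open import Data.Nat.ListAction using (sum)
open import Data.List.Relation.Unary.All using (All)
open import Data.List.Relation.Unary.Linked using (Linked)
open import Data.List.Relation.Unary.Unique.Propositional using (Unique)
open import Data.List.Membership.Propositional using () renaming (_∈_ to _∈ₗ_)
open import Data.Product using (Σ; _×_; _,_; proj₁; proj₂)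
open import Relation.Binary.PropositionalEquality using (_≡_)
open import Relation.Nullary using (¬_)

record SimpleGraph (d : ℕ) : Set where
  field
    adj    : Fin d → Fin d → Bool
    sym    : ∀ i j → adj i j ≡ adj j i
    irrefl : ∀ i → adj i i ≡ false
open SimpleGraph public

numEdges : ∀ {d} → SimpleGraph d → ℕ
numEdges {d} G =
  sum (map (λ i → sum (map (λ j → if (toℕ i <ᵇ toℕ j) ∧ adj G i j then 1 else 0)
                           (allFin d)))
           (allFin d))

word : ∀ {d} → Permutation′ d → List (Fin d)
word {d} π = map (π ⟨$⟩ʳ_) (allFin d)

-- ℓ(k) = largest r such that there are positions i_0 < ⋯ < i_r = k with
-- consecutive letters adjacent; computed as 0 if no earlier adjacent letter,
-- else 1 + max ℓ(j) over earlier positions j with a_j ~ a_k.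
ℓstep : ∀ {d} → SimpleGraph d → List (Fin d × ℕ) → Fin d → ℕ
ℓstep G prev x =
  foldr (λ p m → if adj G (proj₁ p) x then m ⊔ suc (proj₂ p) else m) 0 prev

labelGo : ∀ {d} → SimpleGraph d → List (Fin d × ℕ) → List (Fin d) → List (Fin d × ℕ)
labelGo G prev [] = []
labelGo G prev (x ∷ xs) = (x , ℓstep G prev x) ∷ labelGo G (prev ++ [ (x , ℓstep G prev x) ]) xs

labelled : ∀ {d} → SimpleGraph d → Permutation′ d → List (Fin d × ℕ)
labelled G π = labelGo G [] (word π)

isCut : ∀ {d} → Fin d × ℕ → Fin d × ℕ → Bool
isCut (a , l) (b , m) = (l <ᵇ m) ∨ ((l ≡ᵇ m) ∧ (toℕ a <ᵇ toℕ b))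

-- split the word at the cuts (0 is always a cut)
blocksGo : ∀ {d} → Fin d × ℕ → List (Fin d) → List (Fin d × ℕ) → List (List (Fin d))
blocksGo p cur [] = [ cur ]
blocksGo p cur (q ∷ qs) =
  if isCut p q then cur ∷ blocksGo q [ proj₁ q ] qs
               else blocksGo q (cur ++ [ proj₁ q ]) qs

blocks : ∀ {d} → List (Fin d × ℕ) → List (List (Fin d))
blocks [] = []
blocks (p ∷ ps) = blocksGo p [ proj₁ p ] ps

toSubset : ∀ {d} → List (Fin d) → Subset d
toSubset = foldr (λ x s → ⁅ x ⁆ ∪ s) ⊥

GSeq : ∀ {d} → SimpleGraph d → Permutation′ d → List (Subset d)
GSeq G π = map toSubset (blocks (labelled G π))

dropLast : ∀ {A : Set} → List A → List A
dropLast [] = []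
dropLast (x ∷ []) = []
dropLast (x ∷ y ∷ ys) = x ∷ dropLast (y ∷ ys)

shortGSeq : ∀ {d} → SimpleGraph d → Permutation′ d → List (Subset d)
shortGSeq G π = dropLast (GSeq G π)

IsChain : ∀ {d} → List (Subset d) → Set
IsChain C = All (λ S → ⊥ ⊂ S) C × All (λ S → S ⊂ ⊤) C × Linked _⊂_ C

diffsGo : ∀ {d} → Subset d → List (Subset d) → List (Subset d)
diffsGo prev [] = []
diffsGo prev (S ∷ Ss) = (S ─ prev) ∷ diffsGo S Ss

diffs : ∀ {d} → List (Subset d) → List (Subset d)
diffs [] = []
diffs (S ∷ Ss) = S ∷ diffsGo S Ss

IsBasicChain : ∀ {d} → SimpleGraph d → List (Subset d) → Set
IsBasicChain {d} G C = IsChain C × Σ (Permutation′ d) (λ π → shortGSeq G π ≡ diffs C)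

-- faces of Δ_G: chains (as increasing lists, a canonical representation of
-- the chain as a set) containing no basic chain as a subset
IsFace : ∀ {d} → SimpleGraph d → List (Subset d) → Set
IsFace {d} G F =
  IsChain F × ¬ (Σ (List (Subset d)) λ C → IsBasicChain G C × All (_∈ₗ F) C)

IsFacet : ∀ {d} → SimpleGraph d → List (Subset d) → Set
IsFacet G F = IsFace G F × (∀ F′ → IsFace G F′ → All (_∈ₗ F′) F → All (_∈ₗ F) F′)

HasCount : ∀ {A : Set} → (A → Set) → ℕ → Set
HasCount {A} P n =
  Σ (List A) λ xs → Unique xs × (∀ x → (x ∈ₗ xs → P x) × (P x → x ∈ₗ xs)) × length xs ≡ n

{-# OPTIONS --safe #-}
-- A chain of subsets is a face of Δ_G exactly when it keeps some edge {a, b} together, i.e. none of its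
-- members contains exactly one of a and b. Indeed, the blocks of a G-sequence are independent sets, so
-- the cumulative unions of a basic chain separate every edge. Conversely, if a chain S₁ ⊂ ⋯ ⊂ S_k
-- separates every edge, its layers S₁, S₂ ∖ S₁, …, [d] ∖ S_k are independent; writing them one after
-- another, each in decreasing order of (ℓ, letter), gives a permutation whose cuts all lie between
-- layers, so its basic chain is contained in the chain. A chain keeping {a, b} together refines to the
-- chain of an ordering of the set partition {a, b}, {x} (x ≠ a, b), which has length d − 2; hence the
-- facets are exactly these chains, (d − 1)! for each of the E edges.
module Submission where
open import Defs hiding (sym)
open import Data.Bool using (Bool; true; false; T; if_then_else_; _∧_)
open import Data.Bool.Properties using (¬-not)
import Data.Bool as Bool
open import Data.Empty using (⊥-elim)
open import Data.Fin using (Fin; zero; suc; toℕ; cast; _≟_)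
open import Data.Fin.Properties using (cast-involutive; toℕ-injective; any?)
open import Data.Fin.Permutation using (Permutation′; _⟨$⟩ʳ_; _⟨$⟩ˡ_; inverseʳ; inverseˡ; permutation)
open import Data.Fin.Subset using (Subset; ⊥; ⊤; ⁅_⁆; _∪_; _─_; _⊂_; _⊆_; Nonempty; inside; outside)
  renaming (_∈_ to _∈ₛ_; _∉_ to _∉ₛ_)
open import Data.Fin.Subset.Properties
  using (⊆-antisym; ⊆⊤; ∉⊥; ∈⊤; x∈⁅x⁆; x∈⁅y⁆⇒x≡y; x∈p∪q⁻; p⊆p∪q; q⊆p∪q; x∈p∧x∉q⇒x∈p─q; p─q⊆p; p─⊥≡p;
         ∪-identityˡ; ∪-assoc; _⊆?_; ⊂-trans; ⊂-irref; ⊂-asymmetric)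
  renaming (_∈?_ to _∈ₛ?_)
open import Data.List
  using (List; []; _∷_; [_]; _++_; map; length; concat; concatMap; allFin; filter; foldl; foldr; lookup; tabulate;
         head)
open import Data.List.Properties
  using (length-++; length-map; length-tabulate; ∷-injective; ∷-injectiveˡ; ∷-injectiveʳ; ++-identityʳ; ++-assoc;
         map-tabulate; map-++; map-∘; map-id; map-cong; foldr-++)
open import Data.List.Membership.Propositional using (_∈_; _∉_; find; lose)
open import Data.List.Membership.Propositional.Properties
  using (∈-map⁺; ∈-map⁻; ∈-++⁺ˡ; ∈-++⁺ʳ; ∈-++⁻; ∈-∃++; ∈-allFin; ∈-lookup; ∈-filter⁺; ∈-filter⁻;
         ∈-concat⁺′; ∈-concat⁻′; ∈-concatMap⁺; ∈-concatMap⁻)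
open import Data.List.Membership.Propositional.Properties.WithK using (unique∧set⇒bag; unique⇒irrelevant)
open import Data.List.Relation.Binary.BagAndSetEquality using (∼bag⇒↭)
open import Data.List.Relation.Binary.Permutation.Propositional
  using (_↭_; ↭-refl; ↭-reflexive; ↭-sym; ↭-trans; ↭-prep; ↭-swap; ↭⇒↭ₛ)
open import Data.List.Relation.Binary.Permutation.Propositional.Properties
  using (↭-length; ↭-empty-inv; ∈-resp-↭; shift; drop-mid)
  renaming (map⁺ to ↭-map⁺; ++⁺ to ↭-++⁺)
import Data.List.Relation.Binary.Permutation.Setoid.Properties as ↭ₛ
open import Data.List.Relation.Binary.Subset.Propositional using () renaming (_⊆_ to _⊆ₗ_)
open import Data.List.Relation.Unary.All using (All; []; _∷_)
import Data.List.Relation.Unary.All as All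
import Data.List.Relation.Unary.All.Properties as All
open import Data.List.Relation.Unary.All.Properties using (¬Any⇒All¬)
open import Data.List.Relation.Unary.AllPairs using (AllPairs; []; _∷_)
  renaming (head to AllPairs-head; tail to AllPairs-tail)
import Data.List.Relation.Unary.AllPairs as AllPairs
open import Data.List.Relation.Unary.Any using (Any; here; there; index)
open import Data.List.Relation.Unary.Any.Properties using (lookup-index)
open import Data.List.Relation.Unary.Linked using (Linked; []; [-]; _∷_; head′; tail; _∷′_)
open import Data.List.Relation.Unary.Linked.Properties using (Linked⇒AllPairs)
open import Data.List.Relation.Unary.Unique.Propositional using (Unique)
open import Data.List.Relation.Unary.Unique.Propositional.Properties using (Unique[x∷xs]⇒x∉xs)
import Data.List.Relation.Unary.Unique.Propositional.Properties as Unique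
open import Data.Maybe using (just)
open import Data.Maybe.Relation.Binary.Connected using (Connected; just)
open import Data.Nat using (ℕ; zero; suc; _+_; _*_; _∸_; _≤_; _<_; z≤n; s≤s; _<ᵇ_; _≡ᵇ_; _!)
open import Data.Nat.ListAction using (sum)
open import Data.Nat.Properties
  using (*-comm; ≤-refl; ≤-trans; <⇒≱; ≮⇒≥; m≤n⊔m; m≤m⊔n; suc-injective; <-asym; <-irrefl; <-cmp;
         <ᵇ⇒<; <⇒<ᵇ; ≡ᵇ⇒≡; ∸-+-assoc)
open import Data.Product using (Σ; ∃; ∃₂; _×_; _,_; proj₁; proj₂; uncurry)
open import Data.Sum using (_⊎_; inj₁; inj₂)
open import Data.Unit using (tt)
import Data.Unit as Unit
open import Data.Vec using (_∷_; here; there)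
open import Data.Vec.Properties using (≡-dec)
open import Function using (_∘_; case_of_)
open import Function.Bundles using (mk⇔)
open import Relation.Binary.Definitions using (Transitive; Asymmetric; DecidableEquality; tri<; tri≈; tri>)
open import Relation.Binary.PropositionalEquality
  using (_≡_; _≢_; refl; sym; trans; cong; cong₂; subst; module ≡-Reasoning)
open import Relation.Binary.PropositionalEquality.Properties using (setoid)
open import Relation.Nullary using (¬_; Dec; yes; no; ¬?)
open import Relation.Nullary.Decidable using (_×-dec_; _→-dec_; decidable-stable)

private variable
  A B : Set
  n : ℕ

∈⇒≢[] : ∀ {x : A} {xs} → x ∈ xs → xs ≢ []
∈⇒≢[] x∈ refl = case x∈ of λ ()

Unique-∷ : ∀ {x : A} {xs} → x ∉ xs → Unique xs → Unique (x ∷ xs)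
Unique-∷ x∉xs u = ¬Any⇒All¬ _ x∉xs ∷ u

Unique-tail : ∀ {x : A} {xs} → Unique (x ∷ xs) → Unique xs
Unique-tail (_ ∷ u) = u

Unique-++ʳ : ∀ xs {ys : List A} → Unique (xs ++ ys) → Unique ys
Unique-++ʳ []       u       = u
Unique-++ʳ (x ∷ xs) (_ ∷ u) = Unique-++ʳ xs u

Unique-++⇒disjoint : ∀ xs {ys : List A} {x} → Unique (xs ++ ys) → x ∈ xs → x ∉ ys
Unique-++⇒disjoint (a ∷ xs) u       (here refl) x∈ys = Unique[x∷xs]⇒x∉xs u (∈-++⁺ʳ xs x∈ys)
Unique-++⇒disjoint (a ∷ xs) (_ ∷ u) (there x∈)  x∈ys = Unique-++⇒disjoint xs u x∈ x∈ys

Unique-resp-↭ : ∀ {xs ys : List A} → xs ↭ ys → Unique xs → Unique ys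
Unique-resp-↭ {A = A} p = ↭ₛ.Unique-resp-↭ (setoid A) (↭⇒↭ₛ p)

Unique∧⊆⇒length≤ : ∀ {xs ys : List A} → Unique xs → xs ⊆ₗ ys → length xs ≤ length ys
Unique∧⊆⇒length≤ {xs = []} u xs⊆ys = z≤n
Unique∧⊆⇒length≤ {xs = x ∷ xs} u xs⊆ys with as , bs , refl ← ∈-∃++ (xs⊆ys (here refl)) =
  subst (suc (length xs) ≤_) (sym (↭-length (shift x as bs)))
    (s≤s (Unique∧⊆⇒length≤ (Unique-tail u) xs⊆as++bs))
  where
  xs⊆as++bs : xs ⊆ₗ as ++ bs
  xs⊆as++bs y∈xs with ∈-resp-↭ (shift x as bs) (xs⊆ys (there y∈xs))
  ... | here refl = ⊥-elim (Unique[x∷xs]⇒x∉xs u y∈xs)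
  ... | there y∈  = y∈

Unique∧⊆∧⊇⇒↭ : ∀ {xs ys : List A} → Unique xs → Unique ys → xs ⊆ₗ ys → ys ⊆ₗ xs → xs ↭ ys
Unique∧⊆∧⊇⇒↭ u v xs⊆ys ys⊆xs = ∼bag⇒↭ (unique∧set⇒bag u v (mk⇔ xs⊆ys ys⊆xs))

length-allFin : ∀ n → length (allFin n) ≡ n
length-allFin n = length-tabulate {n = n} (λ i → i)

complete⇒length≡ : ∀ {d} {w : List (Fin d)} → Unique w → (∀ x → x ∈ w) → length w ≡ d
complete⇒length≡ {d} u complete =
  trans (↭-length (Unique∧⊆∧⊇⇒↭ u (Unique.allFin⁺ d) (λ {x} _ → ∈-allFin x) (λ {x} _ → complete x)))
        (length-allFin d)

module _ {A : Set} (_≟_ : DecidableEquality A) where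
  open import Data.List.Membership.DecPropositional _≟_ using (_∈?_)

  ⊆∧length≤⇒⊇ : ∀ {xs ys : List A} → Unique xs → xs ⊆ₗ ys → length ys ≤ length xs → ys ⊆ₗ xs
  ⊆∧length≤⇒⊇ {xs} {ys} u xs⊆ys ys≤xs {y} y∈ys with y ∈? xs
  ... | yes y∈xs = y∈xs
  ... | no y∉xs  = ⊥-elim (<⇒≱ (Unique∧⊆⇒length≤ (Unique-∷ y∉xs u) y∷xs⊆ys) ys≤xs)
    where
    y∷xs⊆ys : y ∷ xs ⊆ₗ ys
    y∷xs⊆ys (here refl) = y∈ys
    y∷xs⊆ys (there x∈)  = xs⊆ys x∈

module _ {R : A → A → Set} (R-trans : Transitive R) (R-asym : Asymmetric R) where

  Linked-head : ∀ {x y xs} → Linked R (x ∷ xs) → y ∈ xs → R x y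
  Linked-head l = All.lookup (AllPairs-head (Linked⇒AllPairs R-trans l))

  Linked-heads-≡ : ∀ {x y xs ys} → Linked R (x ∷ xs) → Linked R (y ∷ ys) →
    x ∈ y ∷ ys → y ∈ x ∷ xs → x ≡ y
  Linked-heads-≡ _  _  (here x≡y)   _            = x≡y
  Linked-heads-≡ _  _  (there _)    (here y≡x)   = sym y≡x
  Linked-heads-≡ lx ly (there x∈ys) (there y∈xs) = ⊥-elim (R-asym (Linked-head ly x∈ys) (Linked-head lx y∈xs))

  Linked-∈-tail : ∀ {x z xs ws} → Linked R (x ∷ xs) → z ∈ xs → z ∈ x ∷ ws → z ∈ ws
  Linked-∈-tail l z∈xs (here refl)  = ⊥-elim (R-asym (Linked-head l z∈xs) (Linked-head l z∈xs))
  Linked-∈-tail _ _    (there z∈ws) = z∈ws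

  Linked-≡ : ∀ {xs ys} → Linked R xs → Linked R ys → xs ⊆ₗ ys → ys ⊆ₗ xs → xs ≡ ys
  Linked-≡ {[]}     {[]}     _  _  _     _     = refl
  Linked-≡ {[]}     {y ∷ ys} _  _  _     ys⊆xs = case ys⊆xs (here refl) of λ ()
  Linked-≡ {x ∷ xs} {[]}     _  _  xs⊆ys _     = case xs⊆ys (here refl) of λ ()
  Linked-≡ {x ∷ xs} {y ∷ ys} lx ly xs⊆ys ys⊆xs
    with refl ← Linked-heads-≡ lx ly (xs⊆ys (here refl)) (ys⊆xs (here refl)) =
    cong (x ∷_) (Linked-≡ (tail lx) (tail ly) (λ z∈xs → Linked-∈-tail lx z∈xs (xs⊆ys (there z∈xs)))
                                              (λ z∈ys → Linked-∈-tail ly z∈ys (ys⊆xs (there z∈ys))))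

Unique⇒AllPairs : ∀ {R : A → A → Set} {xs} → Unique xs → (∀ {x y} → x ∈ xs → y ∈ xs → x ≢ y → R x y) →
  AllPairs R xs
Unique⇒AllPairs {xs = []}     _        _  = []
Unique⇒AllPairs {xs = x ∷ xs} (x∉ ∷ u) R≢ =
  All.tabulate (λ y∈ → R≢ (here refl) (there y∈) (All.lookup x∉ y∈)) ∷
  Unique⇒AllPairs u (λ p q → R≢ (there p) (there q))

Unique-map-injectiveOn : ∀ (f : A → B) {xs} → Unique xs →
  (∀ {x x′} → x ∈ xs → x′ ∈ xs → f x ≡ f x′ → x ≡ x′) → Unique (map f xs)
Unique-map-injectiveOn f {[]}     u inj = []
Unique-map-injectiveOn f {x ∷ xs} u inj =
  Unique-∷ fx∉ (Unique-map-injectiveOn f (Unique-tail u) (λ p q → inj (there p) (there q)))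
  where
  fx∉ : f x ∉ map f xs
  fx∉ fx∈ with x′ , x′∈xs , fx≡fx′ ← ∈-map⁻ f fx∈ =
    Unique[x∷xs]⇒x∉xs u (subst (_∈ xs) (sym (inj (here refl) (there x′∈xs) fx≡fx′)) x′∈xs)

Unique-concatMap : ∀ (f : A → List B) {xs} → Unique xs → (∀ {x} → x ∈ xs → Unique (f x)) →
  (∀ {x x′ y} → x ∈ xs → x′ ∈ xs → y ∈ f x → y ∈ f x′ → x ≡ x′) → Unique (concatMap f xs)
Unique-concatMap f {[]}     u uf inj = []
Unique-concatMap f {x ∷ xs} u uf inj =
  Unique.++⁺ (uf (here refl))
    (Unique-concatMap f (Unique-tail u) (uf ∘ there) (λ p q → inj (there p) (there q))) disjoint
  where
  disjoint : ∀ {y} → ¬ (y ∈ f x × y ∈ concatMap f xs)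
  disjoint (y∈fx , y∈rest) with x′ , x′∈xs , y∈fx′ ← find (∈-concatMap⁻ f y∈rest) =
    Unique[x∷xs]⇒x∉xs u (subst (_∈ xs) (sym (inj (here refl) (there x′∈xs) y∈fx y∈fx′)) x′∈xs)

length-concatMap : ∀ (f : A → List B) xs → length (concatMap f xs) ≡ sum (map (length ∘ f) xs)
length-concatMap f []       = refl
length-concatMap f (x ∷ xs) = trans (length-++ (f x)) (cong (length (f x) +_) (length-concatMap f xs))

sum-map-const : ∀ (g : A → ℕ) {c} xs → (∀ {x} → x ∈ xs → g x ≡ c) → sum (map g xs) ≡ length xs * c
sum-map-const g []       _    = refl
sum-map-const g (x ∷ xs) g≡c = cong₂ _+_ (g≡c (here refl)) (sum-map-const g xs (g≡c ∘ there))

length-concatMap-const : ∀ (f : A → List B) {c} xs → (∀ {x} → x ∈ xs → length (f x) ≡ c) →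
  length (concatMap f xs) ≡ length xs * c
length-concatMap-const f xs h = trans (length-concatMap f xs) (sum-map-const (length ∘ f) xs h)

coincideOnDropLast⇒Any× : ∀ {P Q : A → Set} xs → (∀ {x} → x ∈ dropLast xs → P x → Q x) →
  (∀ {x} → x ∈ dropLast xs → Q x → P x) → Any P xs → Any Q xs → Any (λ x → P x × Q x) xs
coincideOnDropLast⇒Any× (x ∷ [])     P⇒Q Q⇒P (here px) (here qx) = here (px , qx)
coincideOnDropLast⇒Any× (x ∷ y ∷ ys) P⇒Q Q⇒P (here px) _         = here (px , P⇒Q (here refl) px)
coincideOnDropLast⇒Any× (x ∷ y ∷ ys) P⇒Q Q⇒P (there _) (here qx) = here (Q⇒P (here refl) qx , qx)
coincideOnDropLast⇒Any× (x ∷ y ∷ ys) P⇒Q Q⇒P (there p) (there q) =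
  there (coincideOnDropLast⇒Any× (y ∷ ys) (P⇒Q ∘ there) (Q⇒P ∘ there) p q)

dropLast-map : ∀ {B : Set} (f : A → B) xs → dropLast (map f xs) ≡ map f (dropLast xs)
dropLast-map f []           = refl
dropLast-map f (x ∷ [])     = refl
dropLast-map f (x ∷ y ∷ ys) = cong (f x ∷_) (dropLast-map f (y ∷ ys))

-- Permutations of a list

++-∷-cancel : ∀ {x : A} as as′ {bs bs′} → x ∉ as → x ∉ as′ →
  as ++ x ∷ bs ≡ as′ ++ x ∷ bs′ → as ≡ as′ × bs ≡ bs′
++-∷-cancel []       []         _   _    e = refl , ∷-injectiveʳ e
++-∷-cancel []       (a′ ∷ as′) _   x∉as′ e = ⊥-elim (x∉as′ (here (∷-injectiveˡ e)))
++-∷-cancel (a ∷ as) []         x∉as _    e = ⊥-elim (x∉as (here (sym (∷-injectiveˡ e))))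
++-∷-cancel (a ∷ as) (a′ ∷ as′) x∉as x∉as′ e
  with refl , e′ ← ∷-injective e
  with refl , refl ← ++-∷-cancel as as′ (x∉as ∘ there) (x∉as′ ∘ there) e′ = refl , refl

insertions : A → List A → List (List A)
insertions x []       = [ [ x ] ]
insertions x (y ∷ ys) = (x ∷ y ∷ ys) ∷ map (y ∷_) (insertions x ys)

permutations : List A → List (List A)
permutations []       = [ [] ]
permutations (x ∷ xs) = concatMap (insertions x) (permutations xs)

length-insertions : ∀ (x : A) ys → length (insertions x ys) ≡ suc (length ys)
length-insertions x []       = refl
length-insertions x (y ∷ ys) = cong suc (trans (length-map (y ∷_) (insertions x ys)) (length-insertions x ys))

∈-insertions⁻ : ∀ {x : A} ys {zs} → zs ∈ insertions x ys → ∃₂ λ as bs → ys ≡ as ++ bs × zs ≡ as ++ x ∷ bs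
∈-insertions⁻ []       (here refl) = [] , [] , refl , refl
∈-insertions⁻ (y ∷ ys) (here refl) = [] , y ∷ ys , refl , refl
∈-insertions⁻ (y ∷ ys) (there p)
  with ws , ws∈ , refl ← ∈-map⁻ (y ∷_) p
  with as , bs , refl , refl ← ∈-insertions⁻ ys ws∈ = y ∷ as , bs , refl , refl

∈-insertions⁺ : ∀ {x : A} as bs → as ++ x ∷ bs ∈ insertions x (as ++ bs)
∈-insertions⁺ []       []       = here refl
∈-insertions⁺ []       (b ∷ bs) = here refl
∈-insertions⁺ (a ∷ as) bs       = there (∈-map⁺ (a ∷_) (∈-insertions⁺ as bs))

insertions-unique : ∀ (x : A) ys → x ∉ ys → Unique (insertions x ys)
insertions-unique x []       _    = [] ∷ []
insertions-unique x (y ∷ ys) x∉ys =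
  Unique-∷ head∉ (Unique.map⁺ ∷-injectiveʳ (insertions-unique x ys (x∉ys ∘ there)))
  where
  head∉ : x ∷ y ∷ ys ∉ map (y ∷_) (insertions x ys)
  head∉ p with _ , _ , e ← ∈-map⁻ (y ∷_) p = x∉ys (here (∷-injectiveˡ e))

insertions-disjoint : ∀ {x : A} {ys ys′ zs} → x ∉ ys → x ∉ ys′ →
  zs ∈ insertions x ys → zs ∈ insertions x ys′ → ys ≡ ys′
insertions-disjoint {ys = ys} {ys′} x∉ys x∉ys′ p p′
  with as , bs , refl , refl ← ∈-insertions⁻ ys p
  with as′ , bs′ , refl , e ← ∈-insertions⁻ ys′ p′
  with refl , refl ← ++-∷-cancel as as′ (x∉ys ∘ ∈-++⁺ˡ) (x∉ys′ ∘ ∈-++⁺ˡ) e = refl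

∈-permutations⁻ : ∀ (xs : List A) {ys} → ys ∈ permutations xs → ys ↭ xs
∈-permutations⁻ []       (here refl) = ↭-refl
∈-permutations⁻ (x ∷ xs) p
  with ws , ws∈ , zs∈ ← find (∈-concatMap⁻ (insertions x) p)
  with as , bs , refl , refl ← ∈-insertions⁻ ws zs∈ =
    ↭-trans (shift x as bs) (↭-prep x (∈-permutations⁻ xs ws∈))

∈-permutations⁺ : ∀ (xs : List A) {ys} → ys ↭ xs → ys ∈ permutations xs
∈-permutations⁺ []       p rewrite ↭-empty-inv p = here refl
∈-permutations⁺ (x ∷ xs) p with as , bs , refl ← ∈-∃++ (∈-resp-↭ (↭-sym p) (here refl)) =
  ∈-concatMap⁺ (insertions x) (lose (∈-permutations⁺ xs (drop-mid as [] p)) (∈-insertions⁺ as bs))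

length-permutations : ∀ (xs : List A) → length (permutations xs) ≡ length xs !
length-permutations []       = refl
length-permutations (x ∷ xs) = begin
  length (concatMap (insertions x) (permutations xs)) ≡⟨ length-concatMap-const (insertions x) _ lengthEach ⟩
  length (permutations xs) * suc (length xs)          ≡⟨ cong (_* suc (length xs)) (length-permutations xs) ⟩
  length xs ! * suc (length xs)                       ≡⟨ *-comm (length xs !) (suc (length xs)) ⟩
  suc (length xs) !                                   ∎
  where
  open ≡-Reasoning
  lengthEach : ∀ {ws} → ws ∈ permutations xs → length (insertions x ws) ≡ suc (length xs)
  lengthEach {ws} ws∈ = trans (length-insertions x ws) (cong suc (↭-length (∈-permutations⁻ xs ws∈)))

permutations-unique : ∀ {xs : List A} → Unique xs → Unique (permutations xs)
permutations-unique {xs = []}     _ = [] ∷ []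
permutations-unique {xs = x ∷ xs} u =
  Unique-concatMap (insertions x) (permutations-unique (Unique-tail u))
    (λ ws∈ → insertions-unique x _ (x∉ ws∈))
    (λ ws∈ ws′∈ → insertions-disjoint (x∉ ws∈) (x∉ ws′∈))
  where
  x∉ : ∀ {ws} → ws ∈ permutations xs → x ∉ ws
  x∉ ws∈ = Unique[x∷xs]⇒x∉xs u ∘ ∈-resp-↭ (∈-permutations⁻ xs ws∈)

x∈p─q⁻ : ∀ {x : Fin n} (p q : Subset n) → x ∈ₛ p ─ q → x ∈ₛ p × x ∉ₛ q
x∈p─q⁻ {x = x} p q x∈ = p─q⊆p p q x∈ , x∉q p q x∈
  where
  x∉q : ∀ {n} {x : Fin n} (p q : Subset n) → x ∈ₛ p ─ q → x ∉ₛ q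
  x∉q (_ ∷ p) (outside ∷ q) (there x∈) (there x∈q) = x∉q p q x∈ x∈q
  x∉q (_ ∷ p) (inside ∷ q)  (there x∈) (there x∈q) = x∉q p q x∈ x∈q

p∪[q─p]≡q : ∀ {p q : Subset n} → p ⊆ q → p ∪ (q ─ p) ≡ q
p∪[q─p]≡q {p = p} {q} p⊆q = ⊆-antisym ⊆q q⊆
  where
  ⊆q : p ∪ (q ─ p) ⊆ q
  ⊆q x∈ with x∈p∪q⁻ p (q ─ p) x∈
  ... | inj₁ x∈p  = p⊆q x∈p
  ... | inj₂ x∈q─p = p─q⊆p q p x∈q─p
  q⊆ : q ⊆ p ∪ (q ─ p)
  q⊆ {x} x∈q with x ∈ₛ? p
  ... | yes x∈p = p⊆p∪q (q ─ p) x∈p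
  ... | no x∉p  = q⊆p∪q p (q ─ p) (x∈p∧x∉q⇒x∈p─q x∈q x∉p)

∈-toSubset⁺ : ∀ {x : Fin n} {xs} → x ∈ xs → x ∈ₛ toSubset xs
∈-toSubset⁺ {xs = y ∷ xs} (here refl) = p⊆p∪q (toSubset xs) (x∈⁅x⁆ y)
∈-toSubset⁺ {xs = y ∷ xs} (there x∈) = q⊆p∪q ⁅ y ⁆ (toSubset xs) (∈-toSubset⁺ x∈)

∈-toSubset⁻ : ∀ {x : Fin n} xs → x ∈ₛ toSubset xs → x ∈ xs
∈-toSubset⁻ []       x∈ = ⊥-elim (∉⊥ x∈)
∈-toSubset⁻ (y ∷ xs) x∈ with x∈p∪q⁻ ⁅ y ⁆ (toSubset xs) x∈
... | inj₁ x∈⁅y⁆ = here (x∈⁅y⁆⇒x≡y y x∈⁅y⁆)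
... | inj₂ x∈xs  = there (∈-toSubset⁻ xs x∈xs)

elements : Subset n → List (Fin n)
elements {n} p = filter (_∈ₛ? p) (allFin n)

∈-elements⁺ : ∀ {x : Fin n} {p} → x ∈ₛ p → x ∈ elements p
∈-elements⁺ {x = x} x∈p = ∈-filter⁺ (_∈ₛ? _) (∈-allFin x) x∈p

∈-elements⁻ : ∀ {x : Fin n} {p} → x ∈ elements p → x ∈ₛ p
∈-elements⁻ {n} {p = p} x∈ = proj₂ (∈-filter⁻ (_∈ₛ? p) {xs = allFin n} x∈)

elements-unique : ∀ (p : Subset n) → Unique (elements p)
elements-unique {n} p = Unique.filter⁺ (_∈ₛ? p) {xs = allFin n} (Unique.allFin⁺ n)

toSubset-++ : ∀ (xs ys : List (Fin n)) → toSubset (xs ++ ys) ≡ toSubset xs ∪ toSubset ys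
toSubset-++ []       ys = sym (∪-identityˡ (toSubset ys))
toSubset-++ (x ∷ xs) ys =
  trans (cong (⁅ x ⁆ ∪_) (toSubset-++ xs ys)) (sym (∪-assoc ⁅ x ⁆ (toSubset xs) (toSubset ys)))

toSubset-resp-↭ : ∀ {xs ys : List (Fin n)} → xs ↭ ys → toSubset xs ≡ toSubset ys
toSubset-resp-↭ {xs = xs} {ys} xs↭ys =
  ⊆-antisym (∈-toSubset⁺ ∘ ∈-resp-↭ xs↭ys ∘ ∈-toSubset⁻ xs) (∈-toSubset⁺ ∘ ∈-resp-↭ (↭-sym xs↭ys) ∘ ∈-toSubset⁻ ys)

toSubset-elements : ∀ (p : Subset n) → toSubset (elements p) ≡ p
toSubset-elements p = ⊆-antisym (∈-elements⁻ ∘ ∈-toSubset⁻ (elements p)) (∈-toSubset⁺ ∘ ∈-elements⁺)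

-- Chains of subsets: layers and prefix unions

module _ {d : ℕ} where

  ChainFrom : Subset d → List (Subset d) → Set
  ChainFrom P []       = P ⊂ ⊤
  ChainFrom P (S ∷ Ss) = P ⊂ S × ChainFrom S Ss

  IsChain⇒ChainFrom⊥ : 1 ≤ d → ∀ {F} → IsChain F → ChainFrom ⊥ F
  IsChain⇒ChainFrom⊥ (s≤s z≤n) {[]}     _                   = ⊆⊤ , zero , ∈⊤ , ∉⊥
  IsChain⇒ChainFrom⊥ _         {S ∷ Ss} (⊥⊂S ∷ _ , S⊂⊤ , l) = ⊥⊂S , go S⊂⊤ l
    where
    go : ∀ {S Ss} → All (_⊂ ⊤) (S ∷ Ss) → Linked _⊂_ (S ∷ Ss) → ChainFrom S Ss
    go {Ss = []}     (S⊂⊤ ∷ _) _          = S⊂⊤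
    go {Ss = _ ∷ _}  (_ ∷ ⊂⊤)  (S⊂S′ ∷ l) = S⊂S′ , go ⊂⊤ l

  ChainFrom⇒base⊆ : ∀ {P} Ss → ChainFrom P Ss → All (P ⊆_) Ss
  ChainFrom⇒base⊆ []       _               = []
  ChainFrom⇒base⊆ (S ∷ Ss) ((P⊆S , _) , c) = P⊆S ∷ All.map (λ S⊆ {x} x∈P → S⊆ (P⊆S x∈P)) (ChainFrom⇒base⊆ Ss c)

  layers : Subset d → List (Subset d) → List (Subset d)
  layers P []       = [ ⊤ ─ P ]
  layers P (S ∷ Ss) = (S ─ P) ∷ layers S Ss

  some-layer : ∀ P Ss → ∃ (_∈ layers P Ss)
  some-layer P []      = _ , here refl
  some-layer P (_ ∷ _) = _ , here refl

  ∈-layer⇒∉base : ∀ {P} Ss → ChainFrom P Ss → ∀ {D x} → D ∈ layers P Ss → x ∈ₛ D → x ∉ₛ P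
  ∈-layer⇒∉base {P} []       _            (here refl) x∈ = proj₂ (x∈p─q⁻ ⊤ P x∈)
  ∈-layer⇒∉base {P} (S ∷ Ss) _            (here refl) x∈ = proj₂ (x∈p─q⁻ S P x∈)
  ∈-layer⇒∉base     (S ∷ Ss) (P⊂S , c)    (there D∈)  x∈ = ∈-layer⇒∉base Ss c D∈ x∈ ∘ proj₁ P⊂S

  layers-cover : ∀ P Ss {x} → x ∉ₛ P → ∃ λ D → D ∈ layers P Ss × x ∈ₛ D
  layers-cover P []       x∉P = _ , here refl , x∈p∧x∉q⇒x∈p─q ∈⊤ x∉P
  layers-cover P (S ∷ Ss) {x} x∉P with x ∈ₛ? S
  ... | yes x∈S = _ , here refl , x∈p∧x∉q⇒x∈p─q x∈S x∉P
  ... | no x∉S with D , D∈ , x∈D ← layers-cover S Ss x∉S = D , there D∈ , x∈D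

  layers-nonempty : ∀ {P} Ss → ChainFrom P Ss → ∀ {D} → D ∈ layers P Ss → Nonempty D
  layers-nonempty []       (_ , x , x∈ , x∉)       (here refl) = x , x∈p∧x∉q⇒x∈p─q x∈ x∉
  layers-nonempty (S ∷ Ss) ((_ , x , x∈ , x∉) , _) (here refl) = x , x∈p∧x∉q⇒x∈p─q x∈ x∉
  layers-nonempty (S ∷ Ss) (_ , c)                 (there D∈)  = layers-nonempty Ss c D∈

  layers-disjoint : ∀ {P} Ss → ChainFrom P Ss → ∀ {D D′ x} → D ∈ layers P Ss → D′ ∈ layers P Ss →
    x ∈ₛ D → x ∈ₛ D′ → D ≡ D′
  layers-disjoint []       _       (here refl) (here refl) _ _ = refl
  layers-disjoint (S ∷ Ss) _       (here refl) (here refl) _ _ = refl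
  layers-disjoint {P} (S ∷ Ss) (_ , c) (here refl) (there D′∈) x∈D x∈D′ =
    ⊥-elim (∈-layer⇒∉base Ss c D′∈ x∈D′ (proj₁ (x∈p─q⁻ S P x∈D)))
  layers-disjoint {P} (S ∷ Ss) (_ , c) (there D∈) (here refl) x∈D x∈D′ =
    ⊥-elim (∈-layer⇒∉base Ss c D∈ x∈D (proj₁ (x∈p─q⁻ S P x∈D′)))
  layers-disjoint (S ∷ Ss) (_ , c) (there D∈) (there D′∈) x∈D x∈D′ = layers-disjoint Ss c D∈ D′∈ x∈D x∈D′

  layers-unique : ∀ {P} Ss → ChainFrom P Ss → Unique (layers P Ss)
  layers-unique []       _       = [] ∷ []
  layers-unique {P} (S ∷ Ss) (P⊂S , c) = Unique-∷ S─P∉ (layers-unique Ss c)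
    where
    S─P∉ : S ─ P ∉ layers S Ss
    S─P∉ S─P∈ with x , x∈ ← layers-nonempty (S ∷ Ss) (P⊂S , c) (here refl) =
      ∈-layer⇒∉base Ss c S─P∈ x∈ (proj₁ (x∈p─q⁻ S P x∈))

  layers-elements-unique : ∀ {P} Ss → ChainFrom P Ss → Unique (concatMap elements (layers P Ss))
  layers-elements-unique {P} []       _       = subst Unique (sym (++-identityʳ _)) (elements-unique (⊤ ─ P))
  layers-elements-unique {P} (S ∷ Ss) (_ , c) =
    Unique.++⁺ (elements-unique (S ─ P)) (layers-elements-unique Ss c) disjoint
    where
    disjoint : ∀ {x} → ¬ (x ∈ elements (S ─ P) × x ∈ concatMap elements (layers S Ss))
    disjoint {x} (x∈S─P , x∈rest)
      with xs , x∈xs , xs∈ ← ∈-concat⁻′ (map elements (layers S Ss)) x∈rest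
      with D , D∈ , refl ← ∈-map⁻ elements xs∈ =
        ∈-layer⇒∉base Ss c D∈ (∈-elements⁻ x∈xs) (proj₁ (x∈p─q⁻ S P (∈-elements⁻ x∈S─P)))

  layers-elements-cover : ∀ Ss x → x ∈ concatMap elements (layers ⊥ Ss)
  layers-elements-cover Ss x with D , D∈ , x∈D ← layers-cover ⊥ Ss {x} ∉⊥ =
    ∈-concat⁺′ (∈-elements⁺ x∈D) (∈-map⁺ elements D∈)

  KeepsTogether : Fin d → Fin d → Subset d → Set
  KeepsTogether i j S = (i ∈ₛ S → j ∈ₛ S) × (j ∈ₛ S → i ∈ₛ S)

  module _ {i j : Fin d} where

    KeepsTogether-sym : ∀ {S} → KeepsTogether i j S → KeepsTogether j i S
    KeepsTogether-sym (i⇒j , j⇒i) = j⇒i , i⇒j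

    KeepsTogether-─ : ∀ {S P} → KeepsTogether i j S → KeepsTogether i j P → KeepsTogether i j (S ─ P)
    KeepsTogether-─ {S} {P} (i⇒jS , j⇒iS) (i⇒jP , j⇒iP) = move i⇒jS j⇒iP , move j⇒iS i⇒jP
      where
      move : ∀ {x y} → (x ∈ₛ S → y ∈ₛ S) → (y ∈ₛ P → x ∈ₛ P) → x ∈ₛ S ─ P → y ∈ₛ S ─ P
      move x⇒yS y⇒xP x∈ with x∈S , x∉P ← x∈p─q⁻ S P x∈ = x∈p∧x∉q⇒x∈p─q (x⇒yS x∈S) (x∉P ∘ y⇒xP)

    KeepsTogether-∪ : ∀ {P S} → KeepsTogether i j P → KeepsTogether i j S → KeepsTogether i j (P ∪ S)
    KeepsTogether-∪ {P} {S} (i⇒jP , j⇒iP) (i⇒jS , j⇒iS) = move i⇒jP i⇒jS , move j⇒iP j⇒iS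
      where
      move : ∀ {x y} → (x ∈ₛ P → y ∈ₛ P) → (x ∈ₛ S → y ∈ₛ S) → x ∈ₛ P ∪ S → y ∈ₛ P ∪ S
      move x⇒yP x⇒yS x∈ with x∈p∪q⁻ P S x∈
      ... | inj₁ x∈P = p⊆p∪q S (x⇒yP x∈P)
      ... | inj₂ x∈S = q⊆p∪q P S (x⇒yS x∈S)

    KeepsTogether-⊥ : KeepsTogether i j ⊥
    KeepsTogether-⊥ = ⊥-elim ∘ ∉⊥ , ⊥-elim ∘ ∉⊥

    KeepsTogether-⊤ : KeepsTogether i j ⊤
    KeepsTogether-⊤ = (λ _ → ∈⊤) , (λ _ → ∈⊤)

    layers-keepTogether : ∀ {P} Ss → KeepsTogether i j P → All (KeepsTogether i j) Ss →
      All (KeepsTogether i j) (layers P Ss)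
    layers-keepTogether []       kP _           = KeepsTogether-─ KeepsTogether-⊤ kP ∷ []
    layers-keepTogether (S ∷ Ss) kP (kS ∷ kSs) = KeepsTogether-─ kS kP ∷ layers-keepTogether Ss kS kSs

    sameLayer⇒keepsTogether : ∀ {P} Ss → ChainFrom P Ss → ∀ {D} → D ∈ layers P Ss →
      i ∈ₛ D → j ∈ₛ D → All (KeepsTogether i j) Ss
    sameLayer⇒keepsTogether []           _       _           _   _   = []
    sameLayer⇒keepsTogether {P} (S ∷ Ss) (_ , c) (here refl) i∈D j∈D =
      both (i∈S ∷ All.map (λ S⊆ → S⊆ i∈S) (ChainFrom⇒base⊆ Ss c))
           (j∈S ∷ All.map (λ S⊆ → S⊆ j∈S) (ChainFrom⇒base⊆ Ss c))
      where
      i∈S = proj₁ (x∈p─q⁻ S P i∈D)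
      j∈S = proj₁ (x∈p─q⁻ S P j∈D)
      both : ∀ {Ts} → All (i ∈ₛ_) Ts → All (j ∈ₛ_) Ts → All (KeepsTogether i j) Ts
      both []          []          = []
      both (i∈T ∷ i∈s) (j∈T ∷ j∈s) = ((λ _ → j∈T) , (λ _ → i∈T)) ∷ both i∈s j∈s
    sameLayer⇒keepsTogether (S ∷ Ss) (_ , c) (there D∈)  i∈D j∈D =
      (⊥-elim ∘ ∈-layer⇒∉base Ss c D∈ i∈D , ⊥-elim ∘ ∈-layer⇒∉base Ss c D∈ j∈D) ∷
      sameLayer⇒keepsTogether Ss c D∈ i∈D j∈D

    diffs-keepTogether : ∀ Cs → All (KeepsTogether i j) Cs → All (KeepsTogether i j) (diffs Cs)
    diffs-keepTogether []       _          = []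
    diffs-keepTogether (C ∷ Cs) (kC ∷ kCs) = kC ∷ go kC kCs
      where
      go : ∀ {P Cs} → KeepsTogether i j P → All (KeepsTogether i j) Cs → All (KeepsTogether i j) (diffsGo P Cs)
      go kP []         = []
      go kP (kC ∷ kCs) = KeepsTogether-─ kC kP ∷ go kC kCs

  Disjoint : Subset d → Subset d → Set
  Disjoint D D′ = ∀ {x} → x ∈ₛ D → x ∉ₛ D′

  Disjoint-∪ : ∀ {P S D} → Disjoint P D → Disjoint S D → Disjoint (P ∪ S) D
  Disjoint-∪ {P} {S} P#D S#D x∈ with x∈p∪q⁻ P S x∈
  ... | inj₁ x∈P = P#D x∈P
  ... | inj₂ x∈S = S#D x∈S

  Covers : Subset d → List (Subset d) → Set
  Covers P bs = ∀ {x} → x ∉ₛ P → ∃ λ b → b ∈ bs × x ∈ₛ b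

  prefixUnions : Subset d → List (Subset d) → List (Subset d)
  prefixUnions acc []            = []
  prefixUnions acc (b ∷ [])      = []
  prefixUnions acc (b ∷ b′ ∷ bs) = (acc ∪ b) ∷ prefixUnions (acc ∪ b) (b′ ∷ bs)

  chainOf : List (Subset d) → List (Subset d)
  chainOf = prefixUnions ⊥

  length-prefixUnions : ∀ acc bs → length (prefixUnions acc bs) ≡ length bs ∸ 1
  length-prefixUnions acc []            = refl
  length-prefixUnions acc (b ∷ [])      = refl
  length-prefixUnions acc (b ∷ b′ ∷ bs) = cong suc (length-prefixUnions (acc ∪ b) (b′ ∷ bs))

  prefixUnions-keepTogether : ∀ {i j} acc bs → KeepsTogether i j acc → All (KeepsTogether i j) bs →
    All (KeepsTogether i j) (prefixUnions acc bs)
  prefixUnions-keepTogether acc []            _ _          = []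
  prefixUnions-keepTogether acc (b ∷ [])      _ _          = []
  prefixUnions-keepTogether acc (b ∷ b′ ∷ bs) k (kb ∷ kbs) =
    KeepsTogether-∪ k kb ∷ prefixUnions-keepTogether (acc ∪ b) (b′ ∷ bs) (KeepsTogether-∪ k kb) kbs

  prefixUnions-isChain : ∀ acc bs → All (Disjoint acc) bs → AllPairs Disjoint bs → All Nonempty bs →
    IsChain (prefixUnions acc bs)
  prefixUnions-isChain acc []            _ _ _ = [] , [] , []
  prefixUnions-isChain acc (b ∷ [])      _ _ _ = [] , [] , []
  prefixUnions-isChain acc (b ∷ b′ ∷ bs) (_ ∷ acc#b′ ∷ acc#bs) ((b#b′ ∷ b#bs) ∷ pw) ((x , x∈b) ∷ (y , y∈b′) ∷ ne)
    with ⊥⊂ , ⊂⊤ , linked ←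
           prefixUnions-isChain (acc ∪ b) (b′ ∷ bs)
             (All.zipWith (uncurry Disjoint-∪) (acc#b′ ∷ acc#bs , b#b′ ∷ b#bs)) pw ((y , y∈b′) ∷ ne)
    = ((⊥-elim ∘ ∉⊥) , x , q⊆p∪q acc b x∈b , ∉⊥) ∷ ⊥⊂ ,
      (⊆⊤ , y , ∈⊤ , y∉) ∷ ⊂⊤ ,
      link bs linked
    where
    y∉ : y ∉ₛ acc ∪ b
    y∉ y∈ = Disjoint-∪ acc#b′ b#b′ y∈ y∈b′
    link : ∀ cs → Linked _⊂_ (prefixUnions (acc ∪ b) (b′ ∷ cs)) →
      Linked _⊂_ ((acc ∪ b) ∷ prefixUnions (acc ∪ b) (b′ ∷ cs))
    link []       _ = [-]
    link (_ ∷ cs) l = (p⊆p∪q b′ , y , q⊆p∪q (acc ∪ b) b′ y∈b′ , y∉) ∷ l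

  [p∪q]─p≡q : ∀ {p q} → Disjoint p q → (p ∪ q) ─ p ≡ q
  [p∪q]─p≡q {p} {q} p#q = ⊆-antisym ⊆q q⊆
    where
    ⊆q : (p ∪ q) ─ p ⊆ q
    ⊆q x∈ with x∈p∪q , x∉p ← x∈p─q⁻ (p ∪ q) p x∈ with x∈p∪q⁻ p q x∈p∪q
    ... | inj₁ x∈p = ⊥-elim (x∉p x∈p)
    ... | inj₂ x∈q = x∈q
    q⊆ : q ⊆ (p ∪ q) ─ p
    q⊆ x∈q = x∈p∧x∉q⇒x∈p─q (q⊆p∪q p q x∈q) (λ x∈p → p#q x∈p x∈q)

  layers-prefixUnions : ∀ {P} bs → bs ≢ [] → All (Disjoint P) bs → AllPairs Disjoint bs → Covers P bs →
    layers P (prefixUnions P bs) ≡ bs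
  layers-prefixUnions []       bs≢[] _ _ _ = ⊥-elim (bs≢[] refl)
  layers-prefixUnions {P} (b ∷ []) _ (P#b ∷ _) _ cover = cong [_] (⊆-antisym ⊆b b⊆)
    where
    ⊆b : ⊤ ─ P ⊆ b
    ⊆b x∈ with _ , here refl , x∈b ← cover (proj₂ (x∈p─q⁻ ⊤ P x∈)) = x∈b
    b⊆ : b ⊆ ⊤ ─ P
    b⊆ x∈b = x∈p∧x∉q⇒x∈p─q ∈⊤ (λ x∈P → P#b x∈P x∈b)
  layers-prefixUnions {P} (b ∷ b′ ∷ bs) _ (P#b ∷ P#b′ ∷ P#bs) ((b#b′ ∷ b#bs) ∷ pw) cover =
    cong₂ _∷_ ([p∪q]─p≡q P#b)
      (layers-prefixUnions (b′ ∷ bs) (λ ())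
        (All.zipWith (uncurry Disjoint-∪) (P#b′ ∷ P#bs , b#b′ ∷ b#bs)) pw cover′)
    where
    cover′ : Covers (P ∪ b) (b′ ∷ bs)
    cover′ x∉ with cover (x∉ ∘ p⊆p∪q b)
    ... | _ , here refl , x∈b = ⊥-elim (x∉ (q⊆p∪q P b x∈b))
    ... | c , there c∈ , x∈c  = c , c∈ , x∈c

  diffsGo-prefixUnions : ∀ acc bs → All (Disjoint acc) bs → AllPairs Disjoint bs →
    diffsGo acc (prefixUnions acc bs) ≡ dropLast bs
  diffsGo-prefixUnions acc []            _                  _                  = refl
  diffsGo-prefixUnions acc (b ∷ [])      _                  _                  = refl
  diffsGo-prefixUnions acc (b ∷ b′ ∷ bs) (acc#b ∷ acc#rest) ((b#b′ ∷ b#bs) ∷ pw) =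
    cong₂ _∷_ ([p∪q]─p≡q acc#b)
      (diffsGo-prefixUnions (acc ∪ b) (b′ ∷ bs) (All.zipWith (uncurry Disjoint-∪) (acc#rest , b#b′ ∷ b#bs)) pw)

  diffs-prefixUnions : ∀ bs → AllPairs Disjoint bs → diffs (prefixUnions ⊥ bs) ≡ dropLast bs
  diffs-prefixUnions []            _ = refl
  diffs-prefixUnions (b ∷ [])      _ = refl
  diffs-prefixUnions (b ∷ b′ ∷ bs) pw@((b#b′ ∷ b#bs) ∷ _) =
    cong₂ _∷_ (∪-identityˡ b)
      (trans (cong (λ B → diffsGo B (prefixUnions B (b′ ∷ bs))) (∪-identityˡ b))
             (diffsGo-prefixUnions b (b′ ∷ bs) (b#b′ ∷ b#bs) (AllPairs-tail pw)))

  partialUnions : Subset d → List (Subset d) → List (Subset d)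
  partialUnions acc []       = []
  partialUnions acc (b ∷ bs) = (acc ∪ b) ∷ partialUnions (acc ∪ b) bs

  prefixUnions-++ : ∀ acc R c cs →
    prefixUnions acc (R ++ c ∷ cs) ≡ partialUnions acc R ++ prefixUnions (foldl _∪_ acc R) (c ∷ cs)
  prefixUnions-++ acc []           c cs = refl
  prefixUnions-++ acc (r ∷ [])     c cs = refl
  prefixUnions-++ acc (r ∷ r′ ∷ R) c cs = cong ((acc ∪ r) ∷_) (prefixUnions-++ (acc ∪ r) (r′ ∷ R) c cs)

  ∈-prefixUnions-++ˡ : ∀ {X} acc R rest → rest ≢ [] → X ∈ partialUnions acc R → X ∈ prefixUnions acc (R ++ rest)
  ∈-prefixUnions-++ˡ acc R []       rest≢[] _  = ⊥-elim (rest≢[] refl)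
  ∈-prefixUnions-++ˡ acc R (c ∷ cs) _       X∈ = subst (_ ∈_) (sym (prefixUnions-++ acc R c cs)) (∈-++⁺ˡ X∈)

  ∈-prefixUnions-++ʳ : ∀ {X} acc R rest → X ∈ prefixUnions (foldl _∪_ acc R) rest → X ∈ prefixUnions acc (R ++ rest)
  ∈-prefixUnions-++ʳ acc R (c ∷ cs) X∈ =
    subst (_ ∈_) (sym (prefixUnions-++ acc R c cs)) (∈-++⁺ʳ (partialUnions acc R) X∈)

  foldl∈partialUnions : ∀ acc R → R ≢ [] → foldl _∪_ acc R ∈ partialUnions acc R
  foldl∈partialUnions acc []           R≢[] = ⊥-elim (R≢[] refl)
  foldl∈partialUnions acc (r ∷ [])     _    = here refl
  foldl∈partialUnions acc (r ∷ r′ ∷ R) _    = there (foldl∈partialUnions (acc ∪ r) (r′ ∷ R) (λ ()))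

  ∈-foldl-∪⁻ : ∀ {x : Fin d} acc R → x ∈ₛ foldl _∪_ acc R → x ∈ₛ acc ⊎ Any (x ∈ₛ_) R
  ∈-foldl-∪⁻ acc []      x∈ = inj₁ x∈
  ∈-foldl-∪⁻ acc (r ∷ R) x∈ with ∈-foldl-∪⁻ (acc ∪ r) R x∈
  ... | inj₂ x∈R   = inj₂ (there x∈R)
  ... | inj₁ x∈acc∪r with x∈p∪q⁻ acc r x∈acc∪r
  ...   | inj₁ x∈acc = inj₁ x∈acc
  ...   | inj₂ x∈r   = inj₂ (here x∈r)

  ∈-foldl-∪⁺ : ∀ {x : Fin d} acc R → x ∈ₛ acc ⊎ Any (x ∈ₛ_) R → x ∈ₛ foldl _∪_ acc R
  ∈-foldl-∪⁺ acc []      (inj₁ x∈acc)     = x∈acc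
  ∈-foldl-∪⁺ acc (r ∷ R) (inj₁ x∈acc)     = ∈-foldl-∪⁺ (acc ∪ r) R (inj₁ (p⊆p∪q r x∈acc))
  ∈-foldl-∪⁺ acc (r ∷ R) (inj₂ (here x∈r)) = ∈-foldl-∪⁺ (acc ∪ r) R (inj₁ (q⊆p∪q acc r x∈r))
  ∈-foldl-∪⁺ acc (r ∷ R) (inj₂ (there x∈R)) = ∈-foldl-∪⁺ (acc ∪ r) R (inj₂ x∈R)

Unique-concat⇒Disjoint : ∀ {d} (bs : List (List (Fin d))) → Unique (concat bs) → AllPairs Disjoint (map toSubset bs)
Unique-concat⇒Disjoint []       _ = []
Unique-concat⇒Disjoint (b ∷ bs) u =
  All.map⁺ (All.tabulate (λ {B} B∈ x∈b x∈B →
    Unique-++⇒disjoint b u (∈-toSubset⁻ b x∈b) (∈-concat⁺′ (∈-toSubset⁻ B x∈B) B∈))) ∷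
  Unique-concat⇒Disjoint bs (Unique-++ʳ b u)

index-∈-lookup : ∀ {A : Set} (xs : List A) i → index (∈-lookup {xs = xs} i) ≡ i
index-∈-lookup (x ∷ xs) zero    = refl
index-∈-lookup (x ∷ xs) (suc i) = cong suc (index-∈-lookup xs i)

tabulate-lookup-cast : ∀ {A : Set} {m} (w : List A) .(len : length w ≡ m) → tabulate (lookup w ∘ cast (sym len)) ≡ w
tabulate-lookup-cast {m = zero}  []      _   = refl
tabulate-lookup-cast {m = suc m} (x ∷ w) len = cong (x ∷_) (tabulate-lookup-cast w (suc-injective len))

unique∧complete⇒word : ∀ {d} (w : List (Fin d)) → Unique w → (∀ x → x ∈ w) → ∃ λ π → word π ≡ w
unique∧complete⇒word {d} w u complete = permutation at positionOf at∘positionOf positionOf∘at , word≡w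
  where
  len : length w ≡ d
  len = complete⇒length≡ u complete
  at : Fin d → Fin d
  at i = lookup w (cast (sym len) i)
  positionOf : Fin d → Fin d
  positionOf x = cast len (index (complete x))
  at∘positionOf : ∀ x → at (positionOf x) ≡ x
  at∘positionOf x =
    trans (cong (lookup w) (cast-involutive (sym len) len (index (complete x)))) (sym (lookup-index (complete x)))
  positionOf∘at : ∀ i → positionOf (at i) ≡ i
  positionOf∘at i = begin
    cast len (index (complete (at i)))      ≡⟨ cong (cast len ∘ index) (unique⇒irrelevant u (complete (at i)) j∈w) ⟩
    cast len (index j∈w)                    ≡⟨ cong (cast len) (index-∈-lookup w j) ⟩
    cast len j                              ≡⟨ cast-involutive len (sym len) i ⟩
    i                                       ∎
    where
    open ≡-Reasoning
    j = cast (sym len) i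
    j∈w = ∈-lookup {xs = w} j
  word≡w : map at (allFin d) ≡ w
  word≡w = trans (map-tabulate (λ i → i) at) (tabulate-lookup-cast w len)

word-unique : ∀ {d} (π : Permutation′ d) → Unique (word π)
word-unique {d} π = Unique.map⁺ π-injective (Unique.allFin⁺ d)
  where
  π-injective : ∀ {x y} → π ⟨$⟩ʳ x ≡ π ⟨$⟩ʳ y → x ≡ y
  π-injective πx≡πy = trans (sym (inverseˡ π)) (trans (cong (π ⟨$⟩ˡ_) πx≡πy) (inverseˡ π))

∈-word : ∀ {d} (π : Permutation′ d) x → x ∈ word π
∈-word π x = subst (_∈ word π) (inverseʳ π) (∈-map⁺ (π ⟨$⟩ʳ_) (∈-allFin (π ⟨$⟩ˡ x)))

letters : ∀ {d} → List (Fin d × ℕ) → List (Fin d)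
letters = map proj₁

cutFree⇒ℓ≤ : ∀ {d} (p q : Fin d × ℕ) → isCut p q ≡ false → proj₂ q ≤ proj₂ p
cutFree⇒ℓ≤ (a , l) (b , m) noCut with l <ᵇ m in l<ᵇm
... | false = ≮⇒≥ (λ l<m → subst T l<ᵇm (<⇒<ᵇ l<m))

module _ {d : ℕ} where

  NoCut : Fin d × ℕ → Fin d × ℕ → Set
  NoCut p q = isCut p q ≡ false

  isCut⇒lexLess : ∀ (p q : Fin d × ℕ) → isCut p q ≡ true →
    proj₂ p < proj₂ q ⊎ (proj₂ p ≡ proj₂ q × toℕ (proj₁ p) < toℕ (proj₁ q))
  isCut⇒lexLess (a , l) (b , m) cut with l <ᵇ m in l<ᵇm
  ... | true  = inj₁ (<ᵇ⇒< l m (subst T (sym l<ᵇm) tt))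
  ... | false with l ≡ᵇ m in l≡ᵇm | toℕ a <ᵇ toℕ b in a<ᵇb
  ...   | true | true =
    inj₂ (≡ᵇ⇒≡ l m (subst T (sym l≡ᵇm) tt) , <ᵇ⇒< (toℕ a) (toℕ b) (subst T (sym a<ᵇb) tt))

  isCut-asym : ∀ p q → isCut p q ≡ true → NoCut q p
  isCut-asym p q p|q = ¬-not (λ q|p → asym (isCut⇒lexLess p q p|q) (isCut⇒lexLess q p q|p))
    where
    asym : ∀ {l m a b} → l < m ⊎ (l ≡ m × a < b) → ¬ (m < l ⊎ (m ≡ l × b < a))
    asym (inj₁ l<m)        (inj₁ m<l)        = <-asym l<m m<l
    asym (inj₁ l<m)        (inj₂ (refl , _)) = <-irrefl refl l<m
    asym (inj₂ (refl , _)) (inj₁ m<l)        = <-irrefl refl m<l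
    asym (inj₂ (_ , a<b))  (inj₂ (_ , b<a))  = <-asym a<b b<a

  insertByCut : Fin d × ℕ → List (Fin d × ℕ) → List (Fin d × ℕ)
  insertByCut y []       = [ y ]
  insertByCut y (z ∷ zs) with isCut y z
  ... | true  = z ∷ insertByCut y zs
  ... | false = y ∷ z ∷ zs

  sortByCut : List (Fin d × ℕ) → List (Fin d × ℕ)
  sortByCut []       = []
  sortByCut (y ∷ ys) = insertByCut y (sortByCut ys)

  insertByCut-↭ : ∀ y zs → insertByCut y zs ↭ y ∷ zs
  insertByCut-↭ y []       = ↭-refl
  insertByCut-↭ y (z ∷ zs) with isCut y z
  ... | true  = ↭-trans (↭-prep z (insertByCut-↭ y zs)) (↭-swap z y ↭-refl)
  ... | false = ↭-refl

  sortByCut-↭ : ∀ ys → sortByCut ys ↭ ys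
  sortByCut-↭ []       = ↭-refl
  sortByCut-↭ (y ∷ ys) = ↭-trans (insertByCut-↭ y (sortByCut ys)) (↭-prep y (sortByCut-↭ ys))

  insertByCut-head : ∀ {x} y zs → NoCut x y → Connected NoCut (just x) (head zs) →
    Connected NoCut (just x) (head (insertByCut y zs))
  insertByCut-head y []       x|y _   = just x|y
  insertByCut-head y (z ∷ zs) x|y x|z with isCut y z
  ... | true  = x|z
  ... | false = just x|y

  insertByCut-noCut : ∀ y zs → Linked NoCut zs → Linked NoCut (insertByCut y zs)
  insertByCut-noCut y []       _ = [-]
  insertByCut-noCut y (z ∷ zs) l with isCut y z in y|z
  ... | true  = insertByCut-head y zs (isCut-asym y z y|z) (head′ l) ∷′ insertByCut-noCut y zs (tail l)
  ... | false = y|z ∷ l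

  sortByCut-noCut : ∀ ys → Linked NoCut (sortByCut ys)
  sortByCut-noCut []       = []
  sortByCut-noCut (y ∷ ys) = insertByCut-noCut y (sortByCut ys) (sortByCut-noCut ys)

module _ {d : ℕ} (F : List (Subset d)) where

  -- pre lists the letters up to and including p.
  CutPrefixesIn : List (Fin d) → Fin d × ℕ → List (Fin d × ℕ) → Set
  CutPrefixesIn pre p []       = Unit.⊤
  CutPrefixesIn pre p (q ∷ qs) =
    (isCut p q ≡ true → toSubset pre ∈ F) × CutPrefixesIn (pre ++ [ proj₁ q ]) q qs

  cutFreeRun : ∀ pre q s rest → Linked NoCut (q ∷ s) → (∀ p → CutPrefixesIn (pre ++ letters s) p rest) →
    CutPrefixesIn pre q (s ++ rest)
  cutFreeRun pre q []       rest _           after =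
    subst (λ pre′ → CutPrefixesIn pre′ q rest) (++-identityʳ pre) (after q)
  cutFreeRun pre q (q′ ∷ s) rest (q|q′ ∷ l) after =
    (λ cut → case trans (sym cut) q|q′ of λ ()) ,
    cutFreeRun (pre ++ [ proj₁ q′ ]) q′ s rest l
      (λ p → subst (λ pre′ → CutPrefixesIn pre′ p rest) (sym (++-assoc pre [ proj₁ q′ ] (letters s))) (after p))

  cutFreeRunAtBoundary : ∀ pre p s rest → toSubset pre ∈ F → Linked NoCut s →
    (∀ p′ → CutPrefixesIn (pre ++ letters s) p′ rest) → CutPrefixesIn pre p (s ++ rest)
  cutFreeRunAtBoundary pre p []      rest _     _ after =
    subst (λ pre′ → CutPrefixesIn pre′ p rest) (++-identityʳ pre) (after p)
  cutFreeRunAtBoundary pre p (q ∷ s) rest pre∈F l after =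
    (λ _ → pre∈F) ,
    cutFreeRun (pre ++ [ proj₁ q ]) q s rest l
      (λ p′ → subst (λ pre′ → CutPrefixesIn pre′ p′ rest) (sym (++-assoc pre [ proj₁ q ] (letters s))) (after p′))

  cutFreeRunFromStart : ∀ s rest {p qs} → s ++ rest ≡ p ∷ qs → s ≢ [] → Linked NoCut s →
    (∀ p′ → CutPrefixesIn (letters s) p′ rest) → CutPrefixesIn [ proj₁ p ] p qs
  cutFreeRunFromStart []      rest _    s≢[] _ _     = ⊥-elim (s≢[] refl)
  cutFreeRunFromStart (q ∷ s) rest refl _    l after = cutFreeRun [ proj₁ q ] q s rest l after

  cutPrefixesIn⇒prefixUnions∈ : ∀ acc (p : Fin d × ℕ) cur qs → CutPrefixesIn (acc ++ cur) p qs →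
    All (_∈ F) (prefixUnions (toSubset acc) (map toSubset (blocksGo p cur qs)))
  cutPrefixesIn⇒prefixUnions∈ acc p cur []       _            = []
  cutPrefixesIn⇒prefixUnions∈ acc p cur (q ∷ qs) (atCut , cuts) with isCut p q
  ... | true with blocksGo q [ proj₁ q ] qs | cutPrefixesIn⇒prefixUnions∈ (acc ++ cur) q [ proj₁ q ] qs cuts
  ...   | []     | _    = []
  ...   | B ∷ Bs | rest =
    subst (_∈ F) (toSubset-++ acc cur) (atCut refl) ∷
    subst (λ A → All (_∈ F) (prefixUnions A (map toSubset (B ∷ Bs)))) (toSubset-++ acc cur) rest
  cutPrefixesIn⇒prefixUnions∈ acc p cur (q ∷ qs) (atCut , cuts) | false =
    cutPrefixesIn⇒prefixUnions∈ acc q (cur ++ [ proj₁ q ]) qs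
      (subst (λ pre → CutPrefixesIn pre q qs) (++-assoc acc cur [ proj₁ q ]) cuts)

-- G-sequences and basic chains

module GSequence {d : ℕ} (G : SimpleGraph d) where

  Independent : List (Fin d) → Set
  Independent B = ∀ {x y} → x ∈ B → y ∈ B → adj G x y ≡ false

  KeepsAnEdgeTogether : List (Subset d) → Set
  KeepsAnEdgeTogether F = ∃ λ i → ∃ λ j → adj G i j ≡ true × All (KeepsTogether i j) F

  singleton-independent : ∀ {x} → Independent [ x ]
  singleton-independent (here refl) (here refl) = irrefl G _

  ℓ<ℓstep : ∀ {x l y} prev → (x , l) ∈ prev → adj G x y ≡ true → l < ℓstep G prev y
  ℓ<ℓstep {y = y} (p ∷ ps) (here refl) x~y rewrite x~y = m≤n⊔m _ _
  ℓ<ℓstep {y = y} (p ∷ ps) (there x∈) x~y with adj G (proj₁ p) y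
  ... | true  = ≤-trans (ℓ<ℓstep ps x∈ x~y) (m≤m⊔n _ _)
  ... | false = ℓ<ℓstep ps x∈ x~y

  ℓIncreasesAlongEdges : List (Fin d × ℕ) → List (Fin d × ℕ) → Set
  ℓIncreasesAlongEdges prev []       = Unit.⊤
  ℓIncreasesAlongEdges prev (q ∷ qs) =
    (∀ {x l} → (x , l) ∈ prev → adj G x (proj₁ q) ≡ true → l < proj₂ q) × ℓIncreasesAlongEdges (prev ++ [ q ]) qs

  labelGo-ℓIncreases : ∀ prev xs → ℓIncreasesAlongEdges prev (labelGo G prev xs)
  labelGo-ℓIncreases prev []       = tt
  labelGo-ℓIncreases prev (x ∷ xs) = ℓ<ℓstep prev , labelGo-ℓIncreases _ xs

  letters-labelGo : ∀ prev xs → letters (labelGo G prev xs) ≡ xs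
  letters-labelGo prev []       = refl
  letters-labelGo prev (x ∷ xs) = cong (x ∷_) (letters-labelGo _ xs)

  gBlocks : Permutation′ d → List (List (Fin d))
  gBlocks π = blocks (labelled G π)

  blocksGo-independent : ∀ prev p cur qs → ℓIncreasesAlongEdges prev qs →
    All (λ x → ∃ λ l → (x , l) ∈ prev × proj₂ p ≤ l) cur → Independent cur →
    All Independent (blocksGo p cur qs)
  blocksGo-independent prev p cur []       _              _      indep = indep ∷ []
  blocksGo-independent prev p cur (q ∷ qs) (q> , incr) labels indep with isCut p q in cut
  ... | true  = indep ∷ blocksGo-independent (prev ++ [ q ]) q [ proj₁ q ] qs incr
                          ((proj₂ q , ∈-++⁺ʳ prev (here refl) , ≤-refl) ∷ []) singleton-independent
  ... | false = blocksGo-independent (prev ++ [ q ]) q (cur ++ [ proj₁ q ]) qs incr labels′ indep′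
    where
    q≤p : proj₂ q ≤ proj₂ p
    q≤p = cutFree⇒ℓ≤ p q cut
    labels′ : All (λ x → ∃ λ l → (x , l) ∈ prev ++ [ q ] × proj₂ q ≤ l) (cur ++ [ proj₁ q ])
    labels′ = All.++⁺ (All.map (λ (l , x∈ , p≤l) → l , ∈-++⁺ˡ x∈ , ≤-trans q≤p p≤l) labels)
                      ((proj₂ q , ∈-++⁺ʳ prev (here refl) , ≤-refl) ∷ [])
    cur≁q : ∀ {x} → x ∈ cur → adj G x (proj₁ q) ≡ false
    cur≁q {x} x∈cur with l , xl∈ , p≤l ← All.lookup labels x∈cur with adj G x (proj₁ q) in x~q
    ... | false = refl
    ... | true  = ⊥-elim (<⇒≱ (q> xl∈ x~q) (≤-trans q≤p p≤l))
    indep′ : Independent (cur ++ [ proj₁ q ])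
    indep′ {x} {y} x∈ y∈ with ∈-++⁻ cur x∈ | ∈-++⁻ cur y∈
    ... | inj₁ x∈cur       | inj₁ y∈cur       = indep x∈cur y∈cur
    ... | inj₁ x∈cur       | inj₂ (here refl) = cur≁q x∈cur
    ... | inj₂ (here refl) | inj₁ y∈cur       = trans (SimpleGraph.sym G (proj₁ q) y) (cur≁q y∈cur)
    ... | inj₂ (here refl) | inj₂ (here refl) = irrefl G _

  gBlocks-independent : ∀ π → All Independent (gBlocks π)
  gBlocks-independent π with labelled G π | labelGo-ℓIncreases [] (word π)
  ... | []     | _          = []
  ... | p ∷ qs | (_ , incr) =
    blocksGo-independent [ p ] p [ proj₁ p ] qs incr ((proj₂ p , here refl , ≤-refl) ∷ []) singleton-independent

  blocksGo-cover : ∀ {x} (p : Fin d × ℕ) cur qs → x ∈ cur ⊎ x ∈ letters qs → Any (x ∈_) (blocksGo p cur qs)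
  blocksGo-cover p cur []       (inj₁ x∈) = here x∈
  blocksGo-cover p cur (q ∷ qs) x∈ with isCut p q
  blocksGo-cover p cur (q ∷ qs) (inj₁ x∈)           | true  = here x∈
  blocksGo-cover p cur (q ∷ qs) (inj₂ (here refl))  | true  = there (blocksGo-cover q _ qs (inj₁ (here refl)))
  blocksGo-cover p cur (q ∷ qs) (inj₂ (there x∈))   | true  = there (blocksGo-cover q _ qs (inj₂ x∈))
  blocksGo-cover p cur (q ∷ qs) (inj₁ x∈)           | false = blocksGo-cover q _ qs (inj₁ (∈-++⁺ˡ x∈))
  blocksGo-cover p cur (q ∷ qs) (inj₂ (here refl))  | false = blocksGo-cover q _ qs (inj₁ (∈-++⁺ʳ cur (here refl)))
  blocksGo-cover p cur (q ∷ qs) (inj₂ (there x∈))   | false = blocksGo-cover q _ qs (inj₂ x∈)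

  gBlocks-cover : ∀ π x → Any (x ∈_) (gBlocks π)
  gBlocks-cover π x with labelled G π | letters-labelGo [] (word π)
  ... | []     | letters≡ = case subst (x ∈_) (sym letters≡) (∈-word π x) of λ ()
  ... | p ∷ qs | letters≡ with subst (x ∈_) (sym letters≡) (∈-word π x)
  ...   | here refl = blocksGo-cover p [ proj₁ p ] qs (inj₁ (here refl))
  ...   | there x∈  = blocksGo-cover p [ proj₁ p ] qs (inj₂ x∈)

  keepsAnEdgeTogether⇒noBasicSubchain : ∀ {F} → KeepsAnEdgeTogether F →
    ¬ (∃ λ C → IsBasicChain G C × All (_∈ F) C)
  keepsAnEdgeTogether⇒noBasicSubchain {F} (i , j , i~j , kF) (C , (_ , π , shortSeq≡C) , C⊆F) =
    noBlockContainsEdge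
      (coincideOnDropLast⇒Any× (gBlocks π) (nonLast⇒keeps kC) (nonLast⇒keeps (All.map KeepsTogether-sym kC))
        (gBlocks-cover π i) (gBlocks-cover π j))
    where
    noBlockContainsEdge : ¬ Any (λ B → i ∈ B × j ∈ B) (gBlocks π)
    noBlockContainsEdge edgeInBlock with B , B∈ , i∈B , j∈B ← find edgeInBlock =
      case trans (sym i~j) (All.lookup (gBlocks-independent π) B∈ i∈B j∈B) of λ ()
    kC : All (KeepsTogether i j) C
    kC = All.map (All.lookup kF) C⊆F
    nonLast⇒keeps : ∀ {a b} → All (KeepsTogether a b) C → ∀ {B} → B ∈ dropLast (gBlocks π) → a ∈ B → b ∈ B
    nonLast⇒keeps kC {B} B∈ a∈B =
      ∈-toSubset⁻ B (proj₁ (All.lookup (diffs-keepTogether C kC) toSubsetB∈) (∈-toSubset⁺ a∈B))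
      where
      toSubsetB∈ : toSubset B ∈ diffs C
      toSubsetB∈ = subst (toSubset B ∈_) (trans (sym (dropLast-map toSubset (gBlocks π))) shortSeq≡C)
                     (∈-map⁺ toSubset B∈)

module BasicChains {d : ℕ} (G : SimpleGraph d) where
  open GSequence G

  blocksGo-concat : ∀ (p : Fin d × ℕ) cur qs → concat (blocksGo p cur qs) ≡ cur ++ letters qs
  blocksGo-concat p cur []       = trans (++-identityʳ cur) (sym (++-identityʳ cur))
  blocksGo-concat p cur (q ∷ qs) with isCut p q
  ... | true  = cong (cur ++_) (blocksGo-concat q [ proj₁ q ] qs)
  ... | false = trans (blocksGo-concat q (cur ++ [ proj₁ q ]) qs) (++-assoc cur [ proj₁ q ] _)

  blocksGo-nonempty : ∀ (p : Fin d × ℕ) {x} cur qs → x ∈ cur → All (λ B → ∃ (_∈ B)) (blocksGo p cur qs)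
  blocksGo-nonempty p cur []       x∈ = (_ , x∈) ∷ []
  blocksGo-nonempty p cur (q ∷ qs) x∈ with isCut p q
  ... | true  = (_ , x∈) ∷ blocksGo-nonempty q _ qs (here refl)
  ... | false = blocksGo-nonempty q _ qs (∈-++⁺ˡ x∈)

  concat-gBlocks : ∀ π → concat (gBlocks π) ≡ word π
  concat-gBlocks π with labelled G π | letters-labelGo [] (word π)
  ... | []     | letters≡ = letters≡
  ... | p ∷ qs | letters≡ = trans (blocksGo-concat p [ proj₁ p ] qs) letters≡

  gBlocks-nonempty : ∀ π → All (λ B → ∃ (_∈ B)) (gBlocks π)
  gBlocks-nonempty π with labelled G π
  ... | []     = []
  ... | p ∷ qs = blocksGo-nonempty p [ proj₁ p ] qs (here refl)

  basicChainOf : Permutation′ d → List (Subset d)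
  basicChainOf π = chainOf (map toSubset (gBlocks π))

  basicChainOf-isBasic : ∀ π → IsBasicChain G (basicChainOf π)
  basicChainOf-isBasic π =
    prefixUnions-isChain ⊥ (map toSubset (gBlocks π)) (All.map⁺ (All.tabulate (λ _ → ⊥-elim ∘ ∉⊥))) disjoint
      (All.map⁺ (All.map (λ (x , x∈) → x , ∈-toSubset⁺ x∈) (gBlocks-nonempty π))) ,
    π , sym (diffs-prefixUnions (map toSubset (gBlocks π)) disjoint)
    where
    disjoint : AllPairs Disjoint (map toSubset (gBlocks π))
    disjoint = Unique-concat⇒Disjoint (gBlocks π) (subst Unique (sym (concat-gBlocks π)) (word-unique π))

  cutPrefixesIn⇒basicChainOf⊆ : ∀ F π → (∀ {p qs} → labelled G π ≡ p ∷ qs → CutPrefixesIn F [ proj₁ p ] p qs) →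
    All (_∈ F) (basicChainOf π)
  cutPrefixesIn⇒basicChainOf⊆ F π cuts with labelled G π | cuts
  ... | []     | _     = []
  ... | p ∷ qs | cuts′ = cutPrefixesIn⇒prefixUnions∈ F [] p [ proj₁ p ] qs (cuts′ refl)

-- Chains separating every edge

module SeparatingChains {d : ℕ} (G : SimpleGraph d) where
  open GSequence G
  open BasicChains G

  sortedLayer : List (Fin d × ℕ) → List (Fin d) → List (Fin d × ℕ)
  sortedLayer prev B = sortByCut (map (λ x → x , ℓstep G prev x) B)

  layeredWord : List (Fin d × ℕ) → List (List (Fin d)) → List (Fin d × ℕ)
  layeredWord prev []       = []
  layeredWord prev (B ∷ Bs) = sortedLayer prev B ++ layeredWord (prev ++ sortedLayer prev B) Bs

  letters-sortedLayer-↭ : ∀ prev B → letters (sortedLayer prev B) ↭ B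
  letters-sortedLayer-↭ prev B =
    ↭-trans (↭-map⁺ proj₁ (sortByCut-↭ _)) (↭-reflexive (trans (sym (map-∘ B)) (map-id B)))

  ∈-sortedLayer⁻ : ∀ prev B {e} → e ∈ sortedLayer prev B → proj₂ e ≡ ℓstep G prev (proj₁ e) × proj₁ e ∈ B
  ∈-sortedLayer⁻ prev B e∈
    with x , x∈B , refl ← ∈-map⁻ (λ x → x , ℓstep G prev x) (∈-resp-↭ (sortByCut-↭ _) e∈) = refl , x∈B

  letters-layeredWord-↭ : ∀ prev Bs → letters (layeredWord prev Bs) ↭ concat Bs
  letters-layeredWord-↭ prev []       = ↭-refl
  letters-layeredWord-↭ prev (B ∷ Bs) = ↭-trans (↭-reflexive (map-++ proj₁ (sortedLayer prev B) _))
                                          (↭-++⁺ (letters-sortedLayer-↭ prev B) (letters-layeredWord-↭ _ Bs))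

  ℓstep-++-nonadjacent : ∀ prev Z x → All (λ e → adj G (proj₁ e) x ≡ false) Z →
    ℓstep G (prev ++ Z) x ≡ ℓstep G prev x
  ℓstep-++-nonadjacent prev Z x Z≁x = trans (foldr-++ _ 0 prev Z) (cong (λ l → foldr _ l prev) (ℓstep-empty Z Z≁x))
    where
    ℓstep-empty : ∀ Z → All (λ e → adj G (proj₁ e) x ≡ false) Z → ℓstep G Z x ≡ 0
    ℓstep-empty []      []           = refl
    ℓstep-empty (e ∷ Z) (e≁x ∷ Z≁x) rewrite e≁x = ℓstep-empty Z Z≁x

  labelGo-independent : ∀ prev Z {B} s ys → Independent B → All (λ e → proj₁ e ∈ B) Z →
    All (λ e → proj₂ e ≡ ℓstep G prev (proj₁ e) × proj₁ e ∈ B) s →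
    labelGo G (prev ++ Z) (letters s ++ ys) ≡ s ++ labelGo G ((prev ++ Z) ++ s) ys
  labelGo-independent prev Z []      ys indep Z⊆B _ =
    cong (λ acc → labelGo G acc ys) (sym (++-identityʳ (prev ++ Z)))
  labelGo-independent prev Z (e ∷ s) ys indep Z⊆B ((ℓe , e∈B) ∷ s-labelled) = begin
    labelGo G (prev ++ Z) (proj₁ e ∷ letters s ++ ys)
      ≡⟨ cong (λ l → (proj₁ e , l) ∷ labelGo G ((prev ++ Z) ++ [ (proj₁ e , l) ]) (letters s ++ ys)) ℓ≡ ⟩
    e ∷ labelGo G ((prev ++ Z) ++ [ e ]) (letters s ++ ys)
      ≡⟨ cong (λ acc → e ∷ labelGo G acc (letters s ++ ys)) (++-assoc prev Z [ e ]) ⟩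
    e ∷ labelGo G (prev ++ (Z ++ [ e ])) (letters s ++ ys)
      ≡⟨ cong (e ∷_) (labelGo-independent prev (Z ++ [ e ]) s ys indep (All.++⁺ Z⊆B (e∈B ∷ [])) s-labelled) ⟩
    e ∷ s ++ labelGo G ((prev ++ (Z ++ [ e ])) ++ s) ys
      ≡⟨ cong (λ acc → e ∷ s ++ labelGo G acc ys) (trans (++-assoc prev (Z ++ [ e ]) s)
           (trans (cong (prev ++_) (++-assoc Z [ e ] s)) (sym (++-assoc prev Z (e ∷ s))))) ⟩
    e ∷ s ++ labelGo G ((prev ++ Z) ++ e ∷ s) ys ∎
    where
    open ≡-Reasoning
    ℓ≡ : ℓstep G (prev ++ Z) (proj₁ e) ≡ proj₂ e
    ℓ≡ = trans (ℓstep-++-nonadjacent prev Z (proj₁ e) (All.map (λ x∈B → indep x∈B e∈B) Z⊆B)) (sym ℓe)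

  labelGo-layeredWord : ∀ prev Bs → All Independent Bs →
    labelGo G prev (letters (layeredWord prev Bs)) ≡ layeredWord prev Bs
  labelGo-layeredWord prev []       _              = refl
  labelGo-layeredWord prev (B ∷ Bs) (indep ∷ indeps) = begin
    labelGo G prev (letters (s ++ layeredWord (prev ++ s) Bs))
      ≡⟨ cong (labelGo G prev) (map-++ proj₁ s _) ⟩
    labelGo G prev (letters s ++ rest)
      ≡⟨ cong (λ acc → labelGo G acc (letters s ++ rest)) (sym (++-identityʳ prev)) ⟩
    labelGo G (prev ++ []) (letters s ++ rest)
      ≡⟨ labelGo-independent prev [] s _ indep [] (All.tabulate (∈-sortedLayer⁻ prev B)) ⟩
    s ++ labelGo G ((prev ++ []) ++ s) rest
      ≡⟨ cong (λ acc → s ++ labelGo G (acc ++ s) rest) (++-identityʳ prev) ⟩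
    s ++ labelGo G (prev ++ s) rest
      ≡⟨ cong (s ++_) (labelGo-layeredWord (prev ++ s) Bs indeps) ⟩
    s ++ layeredWord (prev ++ s) Bs ∎
    where
    open ≡-Reasoning
    s = sortedLayer prev B
    rest = letters (layeredWord (prev ++ s) Bs)

  toSubset-letters-sortedLayer : ∀ prev D → toSubset (letters (sortedLayer prev (elements D))) ≡ D
  toSubset-letters-sortedLayer prev D =
    trans (toSubset-resp-↭ (letters-sortedLayer-↭ prev (elements D))) (toSubset-elements D)

  sortedLayer-noCut : ∀ prev B → Linked NoCut (sortedLayer prev B)
  sortedLayer-noCut prev B = sortByCut-noCut (map (λ x → x , ℓstep G prev x) B)

  sortedLayer-nonempty : ∀ prev {D} → Nonempty D → sortedLayer prev (elements D) ≢ []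
  sortedLayer-nonempty prev {D} (x , x∈D) s≡[] =
    case subst (λ s → x ∈ letters s) s≡[] x∈ of λ ()
    where
    x∈ : x ∈ letters (sortedLayer prev (elements D))
    x∈ = ∈-resp-↭ (↭-sym (letters-sortedLayer-↭ prev (elements D))) (∈-elements⁺ x∈D)

  layeredWord-cutPrefixes : ∀ {F} prev pre {P} Ss → toSubset pre ≡ P → P ∈ F → ChainFrom P Ss → All (_∈ F) Ss →
    ∀ p → CutPrefixesIn F pre p (layeredWord prev (map elements (layers P Ss)))
  layeredWord-cutPrefixes {F} prev pre {P} [] pre≡P P∈F _ _ p =
    cutFreeRunAtBoundary F pre p (sortedLayer prev (elements (⊤ ─ P))) [] (subst (_∈ F) (sym pre≡P) P∈F)
      (sortedLayer-noCut prev (elements (⊤ ─ P))) (λ _ → tt)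
  layeredWord-cutPrefixes {F} prev pre {P} (S ∷ Ss) pre≡P P∈F ((P⊆S , _) , c) (S∈F ∷ Ss⊆F) p =
    cutFreeRunAtBoundary F pre p s _ (subst (_∈ F) (sym pre≡P) P∈F) (sortedLayer-noCut prev (elements (S ─ P)))
      (layeredWord-cutPrefixes (prev ++ s) (pre ++ letters s) Ss prefix≡S S∈F c Ss⊆F)
    where
    s = sortedLayer prev (elements (S ─ P))
    prefix≡S : toSubset (pre ++ letters s) ≡ S
    prefix≡S = begin
      toSubset (pre ++ letters s)          ≡⟨ toSubset-++ pre (letters s) ⟩
      toSubset pre ∪ toSubset (letters s)  ≡⟨ cong₂ _∪_ pre≡P (toSubset-letters-sortedLayer prev (S ─ P)) ⟩
      P ∪ (S ─ P)                          ≡⟨ p∪[q─p]≡q P⊆S ⟩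
      S                                    ∎
      where open ≡-Reasoning

  layeredWord-cutPrefixesFromStart : ∀ {F} → ChainFrom ⊥ F → All (_∈ F) F →
    ∀ {p qs} → layeredWord [] (map elements (layers ⊥ F)) ≡ p ∷ qs → CutPrefixesIn F [ proj₁ p ] p qs
  layeredWord-cutPrefixesFromStart {[]} c _ L≡ =
    cutFreeRunFromStart [] (sortedLayer [] (elements (⊤ ─ ⊥))) [] L≡
      (sortedLayer-nonempty [] (layers-nonempty [] c (here refl))) (sortedLayer-noCut [] (elements (⊤ ─ ⊥)))
      (λ _ → tt)
  layeredWord-cutPrefixesFromStart {F@(S ∷ Ss)} c@(_ , cS) (S∈F ∷ Ss⊆F) L≡ =
    cutFreeRunFromStart F s _ L≡ (sortedLayer-nonempty [] (layers-nonempty F c (here refl)))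
      (sortedLayer-noCut [] (elements (S ─ ⊥)))
      (layeredWord-cutPrefixes s (letters s) Ss letters≡S S∈F cS Ss⊆F)
    where
    s = sortedLayer [] (elements (S ─ ⊥))
    letters≡S : toSubset (letters s) ≡ S
    letters≡S = trans (toSubset-letters-sortedLayer [] (S ─ ⊥)) (p─⊥≡p S)

  separatesEveryEdge⇒basicSubchain : 1 ≤ d → ∀ {F} → IsChain F →
    (∀ i j → adj G i j ≡ true → ¬ All (KeepsTogether i j) F) → ∃ λ C → IsBasicChain G C × All (_∈ F) C
  separatesEveryEdge⇒basicSubchain d≥1 {F} chain separates =
    basicChainOf π , basicChainOf-isBasic π ,
    cutPrefixesIn⇒basicChainOf⊆ F π
      (λ L≡ → layeredWord-cutPrefixesFromStart cf (All.tabulate (λ S∈F → S∈F)) (trans (sym labelled≡) L≡))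
    where
    cf = IsChain⇒ChainFrom⊥ d≥1 chain
    Bs = map elements (layers ⊥ F)
    L = layeredWord [] Bs
    letters≡ : letters L ↭ concat Bs
    letters≡ = letters-layeredWord-↭ [] Bs
    layers-independent : All Independent Bs
    layers-independent =
      All.map⁺ (All.tabulate λ D∈ {x} {y} x∈ y∈ → nonadjacent D∈ (∈-elements⁻ x∈) (∈-elements⁻ y∈))
      where
      nonadjacent : ∀ {D x y} → D ∈ layers ⊥ F → x ∈ₛ D → y ∈ₛ D → adj G x y ≡ false
      nonadjacent {D} {x} {y} D∈ x∈ y∈ with adj G x y in x~y
      ... | false = refl
      ... | true  = ⊥-elim (separates x y x~y (sameLayer⇒keepsTogether F cf D∈ x∈ y∈))
    permutationOfL : ∃ λ π → word π ≡ letters L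
    permutationOfL = unique∧complete⇒word (letters L) (Unique-resp-↭ (↭-sym letters≡) (layers-elements-unique F cf))
                       (λ x → ∈-resp-↭ (↭-sym letters≡) (layers-elements-cover F x))
    π = proj₁ permutationOfL
    labelled≡ : labelled G π ≡ L
    labelled≡ = trans (cong (labelGo G []) (proj₂ permutationOfL)) (labelGo-layeredWord [] Bs layers-independent)

-- The edge partition {a, b}, {x} (x ≠ a, b)

module EdgePartition {d : ℕ} (a b : Fin d) where

  pair : Subset d
  pair = ⁅ a ⁆ ∪ ⁅ b ⁆

  others : List (Fin d)
  others = filter (λ x → ¬? (x ≟ a) ×-dec ¬? (x ≟ b)) (allFin d)

  edgePartition : List (Subset d)
  edgePartition = pair ∷ map ⁅_⁆ others

  ∈-others⁻ : ∀ {x} → x ∈ others → x ≢ a × x ≢ b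
  ∈-others⁻ x∈ = proj₂ (∈-filter⁻ (λ x → ¬? (x ≟ a) ×-dec ¬? (x ≟ b)) {xs = allFin d} x∈)

  ∈-others⁺ : ∀ {x} → x ≢ a → x ≢ b → x ∈ others
  ∈-others⁺ {x} x≢a x≢b = ∈-filter⁺ (λ x → ¬? (x ≟ a) ×-dec ¬? (x ≟ b)) (∈-allFin x) (x≢a , x≢b)

  ∈-pair⁻ : ∀ {x} → x ∈ₛ pair → x ≡ a ⊎ x ≡ b
  ∈-pair⁻ x∈ with x∈p∪q⁻ ⁅ a ⁆ ⁅ b ⁆ x∈
  ... | inj₁ x∈⁅a⁆ = inj₁ (x∈⁅y⁆⇒x≡y a x∈⁅a⁆)
  ... | inj₂ x∈⁅b⁆ = inj₂ (x∈⁅y⁆⇒x≡y b x∈⁅b⁆)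

  a∈pair : a ∈ₛ pair
  a∈pair = p⊆p∪q ⁅ b ⁆ (x∈⁅x⁆ a)

  b∈pair : b ∈ₛ pair
  b∈pair = q⊆p∪q ⁅ a ⁆ ⁅ b ⁆ (x∈⁅x⁆ b)

  IsBlock : Subset d → Set
  IsBlock B = B ≡ pair ⊎ ∃ λ x → x ≢ a × x ≢ b × B ≡ ⁅ x ⁆

  ∈-edgePartition⁻ : ∀ {B} → B ∈ edgePartition → IsBlock B
  ∈-edgePartition⁻ (here B≡pair) = inj₁ B≡pair
  ∈-edgePartition⁻ (there B∈) with x , x∈ , B≡⁅x⁆ ← ∈-map⁻ ⁅_⁆ B∈ =
    inj₂ (x , proj₁ (∈-others⁻ x∈) , proj₂ (∈-others⁻ x∈) , B≡⁅x⁆)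

  ∈-edgePartition⁺ : ∀ {B} → IsBlock B → B ∈ edgePartition
  ∈-edgePartition⁺ (inj₁ B≡pair)                   = here B≡pair
  ∈-edgePartition⁺ (inj₂ (x , x≢a , x≢b , refl)) = there (∈-map⁺ ⁅_⁆ (∈-others⁺ x≢a x≢b))

  blockOf : ∀ x → ∃ λ B → IsBlock B × x ∈ₛ B
  blockOf x with x ≟ a | x ≟ b
  ... | yes refl | _        = pair , inj₁ refl , a∈pair
  ... | no _     | yes refl = pair , inj₁ refl , b∈pair
  ... | no x≢a   | no x≢b   = ⁅ x ⁆ , inj₂ (x , x≢a , x≢b , refl) , x∈⁅x⁆ x

  IsBlock-keepsTogether : ∀ {B} → IsBlock B → KeepsTogether a b B
  IsBlock-keepsTogether (inj₁ refl)                   = (λ _ → b∈pair) , (λ _ → a∈pair)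
  IsBlock-keepsTogether (inj₂ (x , x≢a , x≢b , refl)) =
    (λ a∈ → ⊥-elim (x≢a (sym (x∈⁅y⁆⇒x≡y x a∈)))) , (λ b∈ → ⊥-elim (x≢b (sym (x∈⁅y⁆⇒x≡y x b∈))))

  IsBlock-nonempty : ∀ {B} → IsBlock B → Nonempty B
  IsBlock-nonempty (inj₁ refl)                   = a , a∈pair
  IsBlock-nonempty (inj₂ (x , _ , _ , refl))     = x , x∈⁅x⁆ x

  IsBlock-overlap : ∀ {B B′ x} → IsBlock B → IsBlock B′ → x ∈ₛ B → x ∈ₛ B′ → B ≡ B′
  IsBlock-overlap (inj₁ refl) (inj₁ refl) _ _ = refl
  IsBlock-overlap (inj₁ refl) (inj₂ (y , y≢a , y≢b , refl)) x∈pair x∈⁅y⁆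
    with refl ← x∈⁅y⁆⇒x≡y y x∈⁅y⁆ with ∈-pair⁻ x∈pair
  ... | inj₁ refl = ⊥-elim (y≢a refl)
  ... | inj₂ refl = ⊥-elim (y≢b refl)
  IsBlock-overlap (inj₂ (y , y≢a , y≢b , refl)) (inj₁ refl) x∈⁅y⁆ x∈pair
    with refl ← x∈⁅y⁆⇒x≡y y x∈⁅y⁆ with ∈-pair⁻ x∈pair
  ... | inj₁ refl = ⊥-elim (y≢a refl)
  ... | inj₂ refl = ⊥-elim (y≢b refl)
  IsBlock-overlap (inj₂ (y , _ , _ , refl)) (inj₂ (z , _ , _ , refl)) x∈⁅y⁆ x∈⁅z⁆
    with refl ← x∈⁅y⁆⇒x≡y y x∈⁅y⁆ | refl ← x∈⁅y⁆⇒x≡y z x∈⁅z⁆ = refl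

  module _ (a≢b : a ≢ b) where

    pair≢⁅⁆ : ∀ {x} → pair ≢ ⁅ x ⁆
    pair≢⁅⁆ {x} pair≡ =
      a≢b (trans (x∈⁅y⁆⇒x≡y x (subst (a ∈ₛ_) pair≡ a∈pair)) (sym (x∈⁅y⁆⇒x≡y x (subst (b ∈ₛ_) pair≡ b∈pair))))

    edgePartition-unique : Unique edgePartition
    edgePartition-unique =
      Unique-∷ (λ pair∈ → let (x , _ , pair≡) = ∈-map⁻ ⁅_⁆ pair∈ in pair≢⁅⁆ pair≡)
        (Unique.map⁺ (λ {x} {y} ⁅x⁆≡⁅y⁆ → x∈⁅y⁆⇒x≡y y (subst (x ∈ₛ_) ⁅x⁆≡⁅y⁆ (x∈⁅x⁆ x)))
          (Unique.filter⁺ (λ x → ¬? (x ≟ a) ×-dec ¬? (x ≟ b)) {xs = allFin d} (Unique.allFin⁺ d)))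

    length-edgePartition : length edgePartition ≡ d ∸ 1
    length-edgePartition = begin
      suc (length (map ⁅_⁆ others)) ≡⟨ cong suc (length-map ⁅_⁆ others) ⟩
      suc (length others)           ≡⟨ cong (_∸ 1) (complete⇒length≡ unique complete) ⟩
      d ∸ 1                         ∎
      where
      open ≡-Reasoning
      unique : Unique (a ∷ b ∷ others)
      unique = Unique-∷ (λ { (here a≡b) → a≢b a≡b ; (there a∈) → proj₁ (∈-others⁻ a∈) refl })
                 (Unique-∷ (λ b∈ → proj₂ (∈-others⁻ b∈) refl)
                   (Unique.filter⁺ (λ x → ¬? (x ≟ a) ×-dec ¬? (x ≟ b)) {xs = allFin d} (Unique.allFin⁺ d)))
      complete : ∀ x → x ∈ a ∷ b ∷ others
      complete x with x ≟ a | x ≟ b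
      ... | yes x≡a | _       = here x≡a
      ... | no _    | yes x≡b = there (here x≡b)
      ... | no x≢a  | no x≢b  = there (there (∈-others⁺ x≢a x≢b))

    IsBlock-⊆ : ∀ {B D x} → IsBlock B → KeepsTogether a b D → x ∈ₛ B → x ∈ₛ D → B ⊆ D
    IsBlock-⊆ (inj₁ refl) (a⇒b , b⇒a) x∈pair x∈D y∈pair with ∈-pair⁻ x∈pair | ∈-pair⁻ y∈pair
    ... | inj₁ refl | inj₁ refl = x∈D
    ... | inj₁ refl | inj₂ refl = a⇒b x∈D
    ... | inj₂ refl | inj₁ refl = b⇒a x∈D
    ... | inj₂ refl | inj₂ refl = x∈D
    IsBlock-⊆ (inj₂ (z , _ , _ , refl)) _ x∈⁅z⁆ x∈D y∈⁅z⁆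
      with refl ← x∈⁅y⁆⇒x≡y z x∈⁅z⁆ | refl ← x∈⁅y⁆⇒x≡y z y∈⁅z⁆ = x∈D

    module _ {bs} (bs↭ : bs ↭ edgePartition) where

      ordering-block : ∀ {B} → B ∈ bs → IsBlock B
      ordering-block = ∈-edgePartition⁻ ∘ ∈-resp-↭ bs↭

      ordering-unique : Unique bs
      ordering-unique = Unique-resp-↭ (↭-sym bs↭) edgePartition-unique

      ordering-disjoint : AllPairs Disjoint bs
      ordering-disjoint = Unique⇒AllPairs ordering-unique
        (λ B∈ B′∈ B≢B′ x∈B x∈B′ → B≢B′ (IsBlock-overlap (ordering-block B∈) (ordering-block B′∈) x∈B x∈B′))

      ordering-covers : ∀ {P} → Covers P bs
      ordering-covers {x = x} _ with B , isBlock , x∈B ← blockOf x =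
        B , ∈-resp-↭ (↭-sym bs↭) (∈-edgePartition⁺ isBlock) , x∈B

      chainOf-ordering-isChain : IsChain (chainOf bs)
      chainOf-ordering-isChain =
        prefixUnions-isChain ⊥ bs (All.tabulate (λ _ → ⊥-elim ∘ ∉⊥)) ordering-disjoint
          (All.tabulate (IsBlock-nonempty ∘ ordering-block))

      chainOf-ordering-keepsTogether : All (KeepsTogether a b) (chainOf bs)
      chainOf-ordering-keepsTogether =
        prefixUnions-keepTogether ⊥ bs KeepsTogether-⊥ (All.tabulate (IsBlock-keepsTogether ∘ ordering-block))

      length-chainOf-ordering : length (chainOf bs) ≡ d ∸ 2
      length-chainOf-ordering = begin
        length (chainOf bs)     ≡⟨ length-prefixUnions ⊥ bs ⟩
        length bs ∸ 1           ≡⟨ cong (_∸ 1) (trans (↭-length bs↭) length-edgePartition) ⟩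
        d ∸ 1 ∸ 1               ≡⟨ ∸-+-assoc d 1 1 ⟩
        d ∸ 2                   ∎
        where open ≡-Reasoning

      layers-chainOf-ordering : layers ⊥ (chainOf bs) ≡ bs
      layers-chainOf-ordering =
        layers-prefixUnions bs (λ { refl → case ∈-resp-↭ (↭-sym bs↭) (here refl) of λ () })
          (All.tabulate (λ _ → ⊥-elim ∘ ∉⊥)) ordering-disjoint ordering-covers

    refineLayer : Subset d → List (Subset d)
    refineLayer D = filter (_⊆? D) edgePartition

    ∈-refineLayer⁻ : ∀ {B D} → B ∈ refineLayer D → B ∈ edgePartition × B ⊆ D
    ∈-refineLayer⁻ {D = D} = ∈-filter⁻ (_⊆? D) {xs = edgePartition}

    blockOf-∈-refineLayer : ∀ {D x} → KeepsTogether a b D → x ∈ₛ D → ∃ λ B → B ∈ refineLayer D × x ∈ₛ B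
    blockOf-∈-refineLayer {D} {x} kD x∈D with B , isBlock , x∈B ← blockOf x =
      B , ∈-filter⁺ (_⊆? D) (∈-edgePartition⁺ isBlock) (IsBlock-⊆ isBlock kD x∈B x∈D) , x∈B

    refineLayer-nonempty : ∀ {D} → KeepsTogether a b D → Nonempty D → refineLayer D ≢ []
    refineLayer-nonempty kD (x , x∈D) = ∈⇒≢[] (proj₁ (proj₂ (blockOf-∈-refineLayer kD x∈D)))

    foldl-refineLayer : ∀ acc {D} → KeepsTogether a b D → foldl _∪_ acc (refineLayer D) ≡ acc ∪ D
    foldl-refineLayer acc {D} kD = ⊆-antisym ⊆acc∪D acc∪D⊆
      where
      ⊆acc∪D : foldl _∪_ acc (refineLayer D) ⊆ acc ∪ D
      ⊆acc∪D x∈ with ∈-foldl-∪⁻ acc (refineLayer D) x∈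
      ... | inj₁ x∈acc = p⊆p∪q D x∈acc
      ... | inj₂ x∈R with B , B∈R , x∈B ← find x∈R = q⊆p∪q acc D (proj₂ (∈-refineLayer⁻ B∈R) x∈B)
      acc∪D⊆ : acc ∪ D ⊆ foldl _∪_ acc (refineLayer D)
      acc∪D⊆ x∈ with x∈p∪q⁻ acc D x∈
      ... | inj₁ x∈acc = ∈-foldl-∪⁺ acc (refineLayer D) (inj₁ x∈acc)
      ... | inj₂ x∈D with B , B∈R , x∈B ← blockOf-∈-refineLayer kD x∈D =
        ∈-foldl-∪⁺ acc (refineLayer D) (inj₂ (lose B∈R x∈B))

    refinement : List (Subset d) → List (Subset d)
    refinement F = concatMap refineLayer (layers ⊥ F)

    -- The union accumulated along the refinement agrees with P only up to ≡, hence the separate acc.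
    chain⊆prefixUnions-refinement : ∀ {P} acc Ss → acc ≡ P → ChainFrom P Ss → KeepsTogether a b P →
      All (KeepsTogether a b) Ss → All (_∈ prefixUnions acc (concatMap refineLayer (layers P Ss))) Ss
    chain⊆prefixUnions-refinement acc []       _    _ _ _ = []
    chain⊆prefixUnions-refinement acc (S ∷ Ss) refl cf@((acc⊆S , _) , chain) kacc (kS ∷ kSs) =
      ∈-prefixUnions-++ˡ acc R rest rest≢[]
        (subst (_∈ partialUnions acc R) foldl≡S (foldl∈partialUnions acc R R≢[])) ∷
      All.map (∈-prefixUnions-++ʳ acc R rest)
        (chain⊆prefixUnions-refinement (foldl _∪_ acc R) Ss foldl≡S chain kS kSs)
      where
      R = refineLayer (S ─ acc)
      rest = concatMap refineLayer (layers S Ss)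
      foldl≡S : foldl _∪_ acc R ≡ S
      foldl≡S = trans (foldl-refineLayer acc (KeepsTogether-─ kS kacc)) (p∪[q─p]≡q acc⊆S)
      R≢[] : R ≢ []
      R≢[] = refineLayer-nonempty (KeepsTogether-─ kS kacc) (layers-nonempty (S ∷ Ss) cf (here refl))
      rest≢[] : rest ≢ []
      rest≢[] with D , D∈ ← some-layer S Ss with x , x∈D ← layers-nonempty Ss chain D∈
        with B , B∈R , _ ← blockOf-∈-refineLayer (All.lookup (layers-keepTogether Ss kS kSs) D∈) x∈D =
        ∈⇒≢[] (∈-concatMap⁺ refineLayer (lose D∈ B∈R))

    module _ {F} (chain : ChainFrom ⊥ F) (kF : All (KeepsTogether a b) F) where

      refinement-↭ : refinement F ↭ edgePartition
      refinement-↭ = Unique∧⊆∧⊇⇒↭ unique edgePartition-unique ⊆edgePartition edgePartition⊆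
        where
        kLayers : All (KeepsTogether a b) (layers ⊥ F)
        kLayers = layers-keepTogether F KeepsTogether-⊥ kF
        unique : Unique (refinement F)
        unique = Unique-concatMap refineLayer (layers-unique F chain)
                   (λ {D} _ → Unique.filter⁺ (_⊆? D) edgePartition-unique) sameLayer
          where
          sameLayer : ∀ {D D′ B} → D ∈ layers ⊥ F → D′ ∈ layers ⊥ F → B ∈ refineLayer D → B ∈ refineLayer D′ →
            D ≡ D′
          sameLayer D∈ D′∈ B∈R B∈R′ with B∈P , B⊆D ← ∈-refineLayer⁻ B∈R
            with x , x∈B ← IsBlock-nonempty (∈-edgePartition⁻ B∈P) =
            layers-disjoint F chain D∈ D′∈ (B⊆D x∈B) (proj₂ (∈-refineLayer⁻ B∈R′) x∈B)
        ⊆edgePartition : ∀ {B} → B ∈ refinement F → B ∈ edgePartition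
        ⊆edgePartition B∈ with _ , _ , B∈R ← find (∈-concatMap⁻ refineLayer {xs = layers ⊥ F} B∈) =
          proj₁ (∈-refineLayer⁻ B∈R)
        edgePartition⊆ : ∀ {B} → B ∈ edgePartition → B ∈ refinement F
        edgePartition⊆ {B} B∈P with x , x∈B ← IsBlock-nonempty (∈-edgePartition⁻ B∈P)
          with D , D∈ , x∈D ← layers-cover ⊥ F {x} ∉⊥ =
          ∈-concatMap⁺ refineLayer
            (lose D∈ (∈-filter⁺ (_⊆? D) B∈P (IsBlock-⊆ (∈-edgePartition⁻ B∈P) (All.lookup kLayers D∈) x∈B x∈D)))

      chain⊆chainOf-refinement : All (_∈ chainOf (refinement F)) F
      chain⊆chainOf-refinement = chain⊆prefixUnions-refinement ⊥ F refl chain KeepsTogether-⊥ kF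

IsChain⇒Unique : ∀ {d} {F : List (Subset d)} → IsChain F → Unique F
IsChain⇒Unique (_ , _ , linked) = AllPairs.map (λ S⊂T S≡T → ⊂-irref S≡T S⊂T) (Linked⇒AllPairs ⊂-trans linked)

_≟ₛ_ : ∀ {d} → DecidableEquality (Subset d)
_≟ₛ_ = ≡-dec Bool._≟_

<⇒≢ : ∀ {d} {a b : Fin d} → toℕ a < toℕ b → a ≢ b
<⇒≢ a<b refl = <-irrefl refl a<b

pair-injective : ∀ {d} {a b a′ b′ : Fin d} → toℕ a < toℕ b → toℕ a′ < toℕ b′ →
  EdgePartition.pair a b ≡ EdgePartition.pair a′ b′ → (a , b) ≡ (a′ , b′)
pair-injective {a = a} {b} {a′} {b′} a<b a′<b′ pair≡
  with ∈-pair⁻ a′ b′ (subst (a ∈ₛ_) pair≡ (a∈pair a b)) | ∈-pair⁻ a′ b′ (subst (b ∈ₛ_) pair≡ (b∈pair a b))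
  where open EdgePartition
... | inj₁ refl | inj₁ refl = ⊥-elim (<-irrefl refl a<b)
... | inj₁ refl | inj₂ refl = refl
... | inj₂ refl | inj₁ refl = ⊥-elim (<-asym a<b a′<b′)
... | inj₂ refl | inj₂ refl = ⊥-elim (<-irrefl refl a<b)

pair∈edgePartition⇒≡ : ∀ {d} {a b a′ b′ : Fin d} → toℕ a < toℕ b → toℕ a′ < toℕ b′ →
  EdgePartition.pair a b ∈ EdgePartition.edgePartition a′ b′ → (a , b) ≡ (a′ , b′)
pair∈edgePartition⇒≡ {a = a} {b} {a′} {b′} a<b a′<b′ pair∈ with EdgePartition.∈-edgePartition⁻ a′ b′ pair∈
... | inj₁ pair≡               = pair-injective a<b a′<b′ pair≡
... | inj₂ (_ , _ , _ , pair≡) = ⊥-elim (EdgePartition.pair≢⁅⁆ a b (<⇒≢ a<b) pair≡)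

chainOf-ordering-injective : ∀ {d} {a b a′ b′ : Fin d} {bs bs′} → a ≢ b → a′ ≢ b′ →
  bs ↭ EdgePartition.edgePartition a b → bs′ ↭ EdgePartition.edgePartition a′ b′ →
  chainOf bs ≡ chainOf bs′ → bs ≡ bs′
chainOf-ordering-injective {a = a} {b} {a′} {b′} a≢b a′≢b′ bs↭ bs′↭ chain≡ =
  trans (sym (EdgePartition.layers-chainOf-ordering a b a≢b bs↭))
    (trans (cong (layers ⊥) chain≡) (EdgePartition.layers-chainOf-ordering a′ b′ a′≢b′ bs′↭))

-- Facets

module Facets {d : ℕ} (d≥1 : 1 ≤ d) (G : SimpleGraph d) where
  open GSequence G
  open SeparatingChains G
  open EdgePartition

  keepsAnEdgeTogether? : ∀ F → Dec (KeepsAnEdgeTogether F)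
  keepsAnEdgeTogether? F =
    any? λ i → any? λ j → (adj G i j Bool.≟ true) ×-dec
      All.all? (λ S → ((i ∈ₛ? S) →-dec (j ∈ₛ? S)) ×-dec ((j ∈ₛ? S) →-dec (i ∈ₛ? S))) F

  isFace⇒keepsAnEdgeTogether : ∀ {F} → IsFace G F → KeepsAnEdgeTogether F
  isFace⇒keepsAnEdgeTogether {F} (chain , noBasicSubchain) =
    decidable-stable (keepsAnEdgeTogether? F) λ noEdgeKept →
      noBasicSubchain (separatesEveryEdge⇒basicSubchain d≥1 chain (λ i j i~j kF → noEdgeKept (i , j , i~j , kF)))

  keepsAnEdgeTogether⇒isFace : ∀ {F} → IsChain F → KeepsAnEdgeTogether F → IsFace G F
  keepsAnEdgeTogether⇒isFace chain keeps = chain , keepsAnEdgeTogether⇒noBasicSubchain keeps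

  isEdge : Fin d → Fin d → Bool
  isEdge i j = (toℕ i <ᵇ toℕ j) ∧ adj G i j

  edgesFrom : Fin d → List (Fin d × Fin d)
  edgesFrom i = concatMap (λ j → if isEdge i j then [ (i , j) ] else []) (allFin d)

  edges : List (Fin d × Fin d)
  edges = concatMap edgesFrom (allFin d)

  length-edges : length edges ≡ numEdges G
  length-edges =
    trans (length-concatMap edgesFrom (allFin d))
      (cong sum (map-cong lengthEach (allFin d)))
    where
    length-if : ∀ c {v : Fin d × Fin d} → length (if c then [ v ] else []) ≡ (if c then 1 else 0)
    length-if true  = refl
    length-if false = refl
    lengthEach : ∀ i → length (edgesFrom i) ≡ sum (map (λ j → if isEdge i j then 1 else 0) (allFin d))
    lengthEach i =
      trans (length-concatMap _ (allFin d)) (cong sum (map-cong (λ j → length-if (isEdge i j)) (allFin d)))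

  ∈-edgesFrom⁻ : ∀ {i e} → e ∈ edgesFrom i → ∃ λ j → isEdge i j ≡ true × e ≡ (i , j)
  ∈-edgesFrom⁻ {i} e∈ with j , _ , e∈if ← find (∈-concatMap⁻ _ {xs = allFin d} e∈) = j , ∈-if⁻ (isEdge i j) e∈if
    where
    ∈-if⁻ : ∀ c {v e : Fin d × Fin d} → e ∈ (if c then [ v ] else []) → c ≡ true × e ≡ v
    ∈-if⁻ true (here e≡v) = refl , e≡v

  ∈-edges⁻ : ∀ {a b} → (a , b) ∈ edges → toℕ a < toℕ b × adj G a b ≡ true
  ∈-edges⁻ e∈ with i , _ , e∈i ← find (∈-concatMap⁻ edgesFrom {xs = allFin d} e∈) with ∈-edgesFrom⁻ e∈i
  ... | j , isEdge≡ , refl with toℕ i <ᵇ toℕ j in i<ᵇj | adj G i j in i~j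
  ...   | true | true = <ᵇ⇒< (toℕ i) (toℕ j) (subst T (sym i<ᵇj) tt) , refl

  ∈-edges⁺ : ∀ {a b} → toℕ a < toℕ b → adj G a b ≡ true → (a , b) ∈ edges
  ∈-edges⁺ {a} {b} a<b a~b =
    ∈-concatMap⁺ edgesFrom (lose (∈-allFin a) (∈-concatMap⁺ _ (lose (∈-allFin b) ab∈)))
    where
    isEdge≡ : isEdge a b ≡ true
    isEdge≡ rewrite a~b with toℕ a <ᵇ toℕ b in a<ᵇb
    ... | true  = refl
    ... | false = ⊥-elim (subst T a<ᵇb (<⇒<ᵇ a<b))
    ab∈ : (a , b) ∈ (if isEdge a b then [ (a , b) ] else [])
    ab∈ rewrite isEdge≡ = here refl

  edges-unique : Unique edges
  edges-unique = Unique-concatMap edgesFrom (Unique.allFin⁺ d) edgesFrom-unique sameSource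
    where
    Unique-if : ∀ c {v : Fin d × Fin d} → Unique (if c then [ v ] else [])
    Unique-if true  = [] ∷ []
    Unique-if false = []
    edgesFrom-unique : ∀ {i} → i ∈ allFin d → Unique (edgesFrom i)
    edgesFrom-unique {i} _ = Unique-concatMap _ (Unique.allFin⁺ d) (λ {j} _ → Unique-if (isEdge i j)) sameTarget
      where
      sameTarget : ∀ {j j′ e} → j ∈ allFin d → j′ ∈ allFin d → e ∈ (if isEdge i j then [ (i , j) ] else []) →
        e ∈ (if isEdge i j′ then [ (i , j′) ] else []) → j ≡ j′
      sameTarget {j} {j′} _ _ e∈ e∈′ with isEdge i j | isEdge i j′ | e∈ | e∈′
      ... | true | true | here refl | here refl = refl
    sameSource : ∀ {i i′ e} → i ∈ allFin d → i′ ∈ allFin d → e ∈ edgesFrom i → e ∈ edgesFrom i′ → i ≡ i′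
    sameSource _ _ e∈ e∈′ with _ , _ , refl ← ∈-edgesFrom⁻ e∈ with _ , _ , e≡ ← ∈-edgesFrom⁻ e∈′ = cong proj₁ e≡

  keepsAnEdgeTogether⇒edge : ∀ {F} → KeepsAnEdgeTogether F →
    ∃ λ a → ∃ λ b → (a , b) ∈ edges × All (KeepsTogether a b) F
  keepsAnEdgeTogether⇒edge (i , j , i~j , kF) with <-cmp (toℕ i) (toℕ j)
  ... | tri< i<j _ _ = i , j , ∈-edges⁺ i<j i~j , kF
  ... | tri≈ _ i≡j _ with refl ← toℕ-injective i≡j = case trans (sym i~j) (irrefl G i) of λ ()
  ... | tri> _ _ j<i = j , i , ∈-edges⁺ j<i (trans (SimpleGraph.sym G j i) i~j) , All.map KeepsTogether-sym kF

  chainsOfEdge : Fin d × Fin d → List (List (Subset d))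
  chainsOfEdge (a , b) = map chainOf (permutations (edgePartition a b))

  maximalChains : List (List (Subset d))
  maximalChains = concatMap chainsOfEdge edges

  length-maximalChains : length maximalChains ≡ numEdges G * (d ∸ 1) !
  length-maximalChains =
    trans (length-concatMap-const chainsOfEdge edges lengthEach) (cong (_* (d ∸ 1) !) length-edges)
    where
    lengthEach : ∀ {e} → e ∈ edges → length (chainsOfEdge e) ≡ (d ∸ 1) !
    lengthEach {a , b} e∈ = begin
      length (map chainOf orderings)  ≡⟨ length-map chainOf orderings ⟩
      length orderings                ≡⟨ length-permutations (edgePartition a b) ⟩
      length (edgePartition a b) !    ≡⟨ cong _! (length-edgePartition a b a≢b) ⟩
      (d ∸ 1) !                       ∎
      where
      open ≡-Reasoning
      orderings = permutations (edgePartition a b)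
      a≢b = <⇒≢ (proj₁ (∈-edges⁻ e∈))

  ∈-chainsOfEdge⁻ : ∀ {a b F} → F ∈ chainsOfEdge (a , b) → ∃ λ bs → bs ↭ edgePartition a b × F ≡ chainOf bs
  ∈-chainsOfEdge⁻ {a} {b} F∈ with bs , bs∈ , F≡ ← ∈-map⁻ chainOf F∈ =
    bs , ∈-permutations⁻ (edgePartition a b) bs∈ , F≡

  ∈-maximalChains⁺ : ∀ {a b} bs → (a , b) ∈ edges → bs ↭ edgePartition a b → chainOf bs ∈ maximalChains
  ∈-maximalChains⁺ {a} {b} bs e∈ bs↭ =
    ∈-concatMap⁺ chainsOfEdge (lose e∈ (∈-map⁺ chainOf (∈-permutations⁺ (edgePartition a b) bs↭)))

  maximalChain-isFace : ∀ {F} → F ∈ maximalChains → IsFace G F × length F ≡ d ∸ 2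
  maximalChain-isFace F∈
    with (a , b) , e∈ , F∈e ← find (∈-concatMap⁻ chainsOfEdge {xs = edges} F∈)
    with bs , bs↭ , refl ← ∈-chainsOfEdge⁻ F∈e =
    keepsAnEdgeTogether⇒isFace (chainOf-ordering-isChain a b a≢b bs↭)
      (a , b , proj₂ (∈-edges⁻ e∈) , chainOf-ordering-keepsTogether a b a≢b bs↭) ,
    length-chainOf-ordering a b a≢b bs↭
    where
    a≢b = <⇒≢ (proj₁ (∈-edges⁻ e∈))

  chain⊆maximalChain : ∀ {F a b} → IsChain F → (a , b) ∈ edges → All (KeepsTogether a b) F →
    ∃ λ F* → F* ∈ maximalChains × All (_∈ F*) F
  chain⊆maximalChain {F} {a} {b} chain e∈ kF =
    chainOf (refinement a b a≢b F) ,
    ∈-maximalChains⁺ (refinement a b a≢b F) e∈ (refinement-↭ a b a≢b cf kF) ,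
    chain⊆chainOf-refinement a b a≢b cf kF
    where
    a≢b : a ≢ b
    a≢b = <⇒≢ (proj₁ (∈-edges⁻ e∈))
    cf : ChainFrom ⊥ F
    cf = IsChain⇒ChainFrom⊥ d≥1 chain

  face⊆maximalChain : ∀ {F} → IsFace G F → ∃ λ F* → F* ∈ maximalChains × All (_∈ F*) F
  face⊆maximalChain face =
    let a , b , e∈ , kF = keepsAnEdgeTogether⇒edge (isFace⇒keepsAnEdgeTogether face)
    in chain⊆maximalChain (proj₁ face) e∈ kF

  length-face : ∀ {F} → IsFace G F → length F ≤ d ∸ 2
  length-face {F} face = length≤ (face⊆maximalChain face)
    where
    length≤ : ∃ (λ F* → F* ∈ maximalChains × All (_∈ F*) F) → length F ≤ d ∸ 2
    length≤ (F* , F*∈ , F⊆F*) =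
      subst (length F ≤_) (proj₂ (maximalChain-isFace F*∈))
        (Unique∧⊆⇒length≤ (IsChain⇒Unique (proj₁ face)) (All.lookup F⊆F*))

  maximalChains-unique : Unique maximalChains
  maximalChains-unique = Unique-concatMap chainsOfEdge edges-unique chainsOfEdge-unique sameEdge
    where
    chainsOfEdge-unique : ∀ {e} → e ∈ edges → Unique (chainsOfEdge e)
    chainsOfEdge-unique {a , b} e∈ =
      Unique-map-injectiveOn chainOf (permutations-unique (edgePartition-unique a b a≢b))
        (λ bs∈ bs′∈ → chainOf-ordering-injective a≢b a≢b (∈-permutations⁻ _ bs∈) (∈-permutations⁻ _ bs′∈))
      where
      a≢b = <⇒≢ (proj₁ (∈-edges⁻ e∈))
    sameEdge : ∀ {e e′ F} → e ∈ edges → e′ ∈ edges → F ∈ chainsOfEdge e → F ∈ chainsOfEdge e′ → e ≡ e′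
    sameEdge {a , b} {a′ , b′} e∈ e′∈ F∈ F∈′
      with bs , bs↭ , refl ← ∈-chainsOfEdge⁻ F∈ | bs′ , bs′↭ , chain≡ ← ∈-chainsOfEdge⁻ F∈′ =
      pair∈edgePartition⇒≡ a<b a′<b′ (∈-resp-↭ bs′↭ (subst (pair a b ∈_) bs≡bs′ (∈-resp-↭ (↭-sym bs↭) (here refl))))
      where
      a<b = proj₁ (∈-edges⁻ e∈)
      a′<b′ = proj₁ (∈-edges⁻ e′∈)
      bs≡bs′ = chainOf-ordering-injective (<⇒≢ a<b) (<⇒≢ a′<b′) bs↭ bs′↭ chain≡

  longFace-isFacet : ∀ {F} → IsFace G F → length F ≡ d ∸ 2 → IsFacet G F
  longFace-isFacet {F} face length≡ = face , maximal
    where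
    maximal : ∀ F′ → IsFace G F′ → All (_∈ F′) F → All (_∈ F) F′
    maximal F′ face′ F⊆F′ = All.tabulate (⊆∧length≤⇒⊇ _≟ₛ_ (IsChain⇒Unique (proj₁ face)) (All.lookup F⊆F′)
                                            (subst (length F′ ≤_) (sym length≡) (length-face face′)))

  facet∈maximalChains : ∀ {F} → IsFacet G F → F ∈ maximalChains
  facet∈maximalChains {F} (face , maximal) = equalsMaximalChain (face⊆maximalChain face)
    where
    equalsMaximalChain : ∃ (λ F* → F* ∈ maximalChains × All (_∈ F*) F) → F ∈ maximalChains
    equalsMaximalChain (F* , F*∈ , F⊆F*) = subst (_∈ maximalChains) (sym F≡F*) F*∈
      where
      face* = proj₁ (maximalChain-isFace F*∈)
      F≡F* : F ≡ F*
      F≡F* = Linked-≡ ⊂-trans ⊂-asymmetric (proj₂ (proj₂ (proj₁ face))) (proj₂ (proj₂ (proj₁ face*)))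
               (All.lookup F⊆F*) (All.lookup (maximal F* face* F⊆F*))

  ∈maximalChains⇔isFacet : ∀ F → (F ∈ maximalChains → IsFacet G F) × (IsFacet G F → F ∈ maximalChains)
  ∈maximalChains⇔isFacet F = (λ F∈ → uncurry longFace-isFacet (maximalChain-isFace F∈)) , facet∈maximalChains

  ∈maximalChains⇔longFace : ∀ F →
    (F ∈ maximalChains → IsFace G F × length F ≡ d ∸ 2) × (IsFace G F × length F ≡ d ∸ 2 → F ∈ maximalChains)
  ∈maximalChains⇔longFace F = maximalChain-isFace , facet∈maximalChains ∘ uncurry longFace-isFacet

corollary3p6 : (d : ℕ) → 1 ≤ d → (G : SimpleGraph d) →
    HasCount (IsFacet G) (numEdges G * (d ∸ 1) !)
    × Σ ℕ (λ m → (∀ (F : List (Subset d)) → IsFace G F → length F ≤ m)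
    × HasCount (λ F → IsFace G F × length F ≡ m) (numEdges G * (d ∸ 1) !))
corollary3p6 d d≥1 G =
  (maximalChains , maximalChains-unique , ∈maximalChains⇔isFacet , length-maximalChains) ,
  d ∸ 2 , (λ _ → length-face) ,
  (maximalChains , maximalChains-unique , ∈maximalChains⇔longFace , length-maximalChains)
  where open Facets d≥1 G
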